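{- Let $k>5$ be an integer, $w_k=\Big(\prod_{i=2}^{k-1}{\tt a}{\tt b}^i{\tt a}{\tt a}\cdot{\tt a}{\tt b}^i{\tt a}{\tt b}{\tt a}^{i-2}\Big)\cdot{\tt a}{\tt b}^k{\tt a}$, let $\widehat{w_k}$ be $w_k$ with its last character removed, and write $\beta(x)=\beta(x,\widehat{w_k})$. Then $\beta({\tt a}^i{\tt b})={\tt b}{\tt a}^{k-i-2}$ for all $4\le i\le k-2$; $\beta({\tt a}^3{\tt b})={\tt b}^5({\tt a}{\tt b})^{k-6}{\tt a}$; $\beta({\tt a}^2{\tt b})={\tt a}{\tt a}{\tt b}{\tt a}^{2k-8}$; $\beta({\tt a}{\tt b})={\tt b}^{k-2}{\tt b}{\tt a}{\tt b}{\tt a}^{2k-6}$; $\beta({\tt b}{\tt a})={\tt a}^{k-5}{\tt b}{\tt b}{\tt b}{\tt a}{\tt b}^{k-5}{\tt a}{\tt b}^{k-2}{\tt b}{\tt a}$; $\beta({\tt b}^j{\tt a})={\tt a}{\tt b}^{2k-2j-2}{\tt a}{\tt b}$ for all $2\le j\le k-1$; and $\beta({\tt b}^k{\tt a})={\tt a}$. Hence $\mathrm{BWT}(\widehat{w_k})=\prod_{i=2}^{k-1}\beta({\tt a}^{k-i}{\tt b})\cdot\prod_{i=1}^{k}\beta({\tt b}^i{\tt a})$, and $r(\widehat{w_k})=8k-20$.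
   Context: Alphabet $\{{\tt a},{\tt b}\}$ with ${\tt a}<{\tt b}$; $\prod$ is concatenation in increasing index order. For a word $w$ of length $n$, $\mathrm{BWT}(w)$ is obtained by sorting the conjugates $w[i..n-1]w[0..i-1]$ lexicographically and concatenating their last characters; $r(w)$ is the number of maximal equal-letter runs of $\mathrm{BWT}(w)$. For words $x,w$, $\beta(x,w)$ is the factor of $\mathrm{BWT}(w)$ formed by the last characters of the conjugates of $w$ having $x$ as a prefix (a contiguous range in sorted order). -}

module Defs where

open import Data.Nat using (ℕ; zero; suc; _+_; _∸_)
open import Data.Bool using (Bool; true; false; _∧_)
open import Data.List using (List; []; _∷_; _++_; map; concat; replicate; applyUpTo; filter; length; drop; take)
open import Relation.Nullary using (Dec; yes; no)
open import Relation.Binary.PropositionalEquality using (_≡_; refl)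

data Letter : Set where
  a b : Letter

Word : Set
Word = List Letter

_<ᴸ_ : Letter → Letter → Bool
a <ᴸ b = true
_ <ᴸ _ = false

_==ᴸ_ : Letter → Letter → Bool
a ==ᴸ a = true
b ==ᴸ b = true
_ ==ᴸ _ = false

lexLeq : Word → Word → Bool
lexLeq [] _ = true
lexLeq (_ ∷ _) [] = false
lexLeq (x ∷ xs) (y ∷ ys) with x <ᴸ y | x ==ᴸ y
... | true | _ = true
... | false | true = lexLeq xs ys
... | false | false = false

insert : Word → List Word → List Word
insert u [] = u ∷ []
insert u (v ∷ vs) with lexLeq u v
... | true = u ∷ v ∷ vs
... | false = v ∷ insert u vs

sort : List Word → List Word
sort [] = []
sort (u ∷ us) = insert u (sort us)

rotate : ℕ → Word → Word
rotate i w = drop i w ++ take i w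

conjugates : Word → List Word
conjugates w = applyUpTo (λ i → rotate i w) (length w)

-- last character of a word (default only used for the empty word,
-- which never occurs among conjugates)
lastChar : Word → Letter
lastChar [] = a
lastChar (x ∷ []) = x
lastChar (_ ∷ y ∷ ys) = lastChar (y ∷ ys)

BWT : Word → Word
BWT w = map lastChar (sort (conjugates w))

runsFrom : Letter → Word → ℕ
runsFrom _ [] = 0
runsFrom p (x ∷ xs) with p ==ᴸ x
... | true = runsFrom x xs
... | false = suc (runsFrom x xs)

runs : Word → ℕ
runs [] = 0
runs (x ∷ xs) = suc (runsFrom x xs)

r : Word → ℕ
r w = runs (BWT w)

isPrefix : Word → Word → Bool
isPrefix [] _ = true
isPrefix (_ ∷ _) [] = false
isPrefix (x ∷ xs) (y ∷ ys) = (x ==ᴸ y) ∧ isPrefix xs ys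

β : Word → Word → Word
β x w = map lastChar (filter (λ u → Data.Bool._≟_ (isPrefix x u) true) (sort (conjugates w)))
  where import Data.Bool

_^_ : Letter → ℕ → Word
c ^ n = replicate n c

_^ʷ_ : Word → ℕ → Word
u ^ʷ n = concat (replicate n u)

range : ℕ → ℕ → List ℕ
range m n = applyUpTo (m +_) (suc n ∸ m)

prod : ℕ → ℕ → (ℕ → Word) → Word
prod m n f = concat (map f (range m n))

w : ℕ → Word
w k = prod 2 (k ∸ 1) (λ i → (a ∷ []) ++ (b ^ i) ++ (a ∷ a ∷ []) ++ (a ∷ []) ++ (b ^ i) ++ (a ∷ b ∷ []) ++ (a ^ (i ∸ 2)))
      ++ (a ∷ []) ++ (b ^ k) ++ (a ∷ [])

dropLast : Word → Word
dropLast [] = []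
dropLast (_ ∷ []) = []
dropLast (x ∷ y ∷ ys) = x ∷ dropLast (y ∷ ys)

ŵ : ℕ → Word
ŵ k = dropLast (w k)

-- Write k = 6 + n. Rotating each factor a b^i aaa b^i ab a^(i-2) of w_k by one letter gives
-- ŵ_k = a B_2 ⋯ B_(k-1) b^k with blocks B_i = b^i aaa b^i ab a^(i-1). A conjugate of ŵ_k
-- starts either inside the final run b^k, or inside a block B_i = x y, and is then y K_i x,
-- where K_i, the rest of the cyclic word, begins with b^(i+1) a (followed by another a unless
-- i = k - 1). So any two conjugates are compared on a short explicit prefix, and all of them can
-- be listed in sorted order: grouped by their prefix a^m b (m decreasing), then b^j a
-- (j increasing). That list is strictly increasing, consists of conjugates and has |ŵ_k|
-- entries, so it is the sorted list of conjugates. Each β is the sequence of last letters of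
-- one group, and the resulting BWT is explicit enough to count its runs.

module Submission where

open import Defs
open import Data.Bool using (true; false)
import Data.Bool as Bool
open import Data.Empty using (⊥-elim)
open import Data.List using (List; []; _∷_; _++_; map; concat; filter; foldl; foldr; head; length; drop; take; applyUpTo; replicate)
open import Data.List.Properties
  using ( ++-assoc; ++-identityʳ; ≡-dec; length-++; length-++-sucʳ; length-map; length-replicate; length-applyUpTo
        ; map-++; map-∘; map-cong-local; concat-++; foldl-++; foldr-++; filter-++; filter-all; filter-none )
open import Data.List.Membership.Propositional using (_∈_)
open import Data.List.Membership.Propositional.Properties using (∈-∃++; ∈-++⁻; ∈-++⁺ˡ; ∈-++⁺ʳ; ∈-applyUpTo⁺)
open import Data.List.Relation.Binary.Equality.Propositional using (≋⇒≡)
open import Data.List.Relation.Binary.Permutation.Propositional using (_↭_; ↭-refl; ↭-sym; ↭-trans; ↭-prep; ↭⇒↭ₛ′)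
open import Data.List.Relation.Binary.Permutation.Propositional.Properties using (shift)
open import Data.List.Relation.Binary.Subset.Propositional using (_⊆_)
open import Data.List.Relation.Unary.All as All using (All; []; _∷_)
import Data.List.Relation.Unary.All.Properties as All
open import Data.List.Relation.Unary.AllPairs as AllPairs using (AllPairs; []; _∷_)
import Data.List.Relation.Unary.AllPairs.Properties as AllPairs
open import Data.List.Relation.Unary.Any using (here; there)
open import Data.List.Relation.Unary.Linked using (Linked; []; [-]; _∷_; _∷′_)
open import Data.List.Relation.Unary.Linked.Properties using (AllPairs⇒Linked; Linked⇒AllPairs)
open import Data.List.Relation.Unary.Sorted.TotalOrder.Properties using (↗↭↗⇒≋)
open import Data.List.Relation.Unary.Unique.Propositional using (Unique)
import Data.List.Sort.InsertionSort.Base as InsertionSort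
open import Data.List.Sort.InsertionSort.Properties using (sort-↗; sort-↭)
open import Data.Maybe using (just)
open import Data.Maybe.Relation.Binary.Connected using (Connected; just; just-nothing)
open import Data.Nat using (ℕ; zero; suc; _+_; _*_; _∸_; _≤_; _<_; z≤n; s≤s; z<s)
open import Data.Nat.ListAction using (sum)
open import Data.Nat.ListAction.Properties using (sum-++)
open import Data.Nat.Properties
  using ( suc-injective; +-suc; +-identityʳ; +-assoc; +-comm; *-suc; *-zeroʳ; +-cancelʳ-≡; *-cancelˡ-≡
        ; ≤-refl; ≤-trans; ≤-pred; <-trans; <-≤-trans; ≤-<-trans; <-irrefl; <⇒≤; <⇒≢; >⇒≢
        ; n≤1+n; m≤m+n; m<m+n; m≤n⇒m≤1+n; m≤n⇒m<n∨m≡n; m≤n⇒∃[o]m+o≡n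
        ; +-∸-assoc; ∸-+-assoc; m+[n∸m]≡n; m∸n+n≡m; m+n∸m≡n; n∸n≡0; m>n⇒m∸n≢0 )
open import Data.Nat.Tactic.RingSolver using (solve-∀)
open import Data.Product using (_×_; _,_; ∃-syntax)
open import Data.Sum using (_⊎_; inj₁; inj₂)
open import Function using (_∘_)
open import Level using (Level)
open import Relation.Binary.Bundles using (DecTotalOrder)
open import Relation.Binary.Core using (Rel)
open import Relation.Binary.Definitions using (DecidableEquality)
open import Relation.Binary.PropositionalEquality
  using (_≡_; _≢_; refl; sym; trans; cong; cong₂; subst; subst₂; isEquivalence; module ≡-Reasoning)
open import Relation.Nullary using (yes; no)
open import Relation.Unary using (Decidable)

open ≡-Reasoning

private
  variable
    ℓ : Level
    A : Set

-- Lexicographic order and sorting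

_≤ˡ_ : Word → Word → Set
u ≤ˡ v = lexLeq u v ≡ true

_<ˡ_ : Word → Word → Set
u <ˡ v = lexLeq v u ≡ false

lexLeq-refl : ∀ u → u ≤ˡ u
lexLeq-refl [] = refl
lexLeq-refl (a ∷ u) = lexLeq-refl u
lexLeq-refl (b ∷ u) = lexLeq-refl u

lexLeq-antisym : ∀ {u v} → u ≤ˡ v → v ≤ˡ u → u ≡ v
lexLeq-antisym {[]} {[]} p q = refl
lexLeq-antisym {a ∷ u} {a ∷ v} p q = cong (a ∷_) (lexLeq-antisym p q)
lexLeq-antisym {b ∷ u} {b ∷ v} p q = cong (b ∷_) (lexLeq-antisym p q)
lexLeq-antisym {[]} {_ ∷ _} p ()
lexLeq-antisym {a ∷ u} {b ∷ v} p ()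
lexLeq-antisym {_ ∷ _} {[]} () q
lexLeq-antisym {b ∷ u} {a ∷ v} () q

lexLeq-trans : ∀ {u v w} → u ≤ˡ v → v ≤ˡ w → u ≤ˡ w
lexLeq-trans {[]} p q = refl
lexLeq-trans {a ∷ u} {a ∷ v} {a ∷ w} p q = lexLeq-trans {u} p q
lexLeq-trans {a ∷ u} {a ∷ v} {b ∷ w} p q = refl
lexLeq-trans {a ∷ u} {b ∷ v} {b ∷ w} p q = refl
lexLeq-trans {b ∷ u} {b ∷ v} {b ∷ w} p q = lexLeq-trans {u} p q
lexLeq-trans {_ ∷ _} {[]} () q
lexLeq-trans {_ ∷ _} {_ ∷ _} {[]} p ()
lexLeq-trans {a ∷ u} {b ∷ v} {a ∷ w} p ()
lexLeq-trans {b ∷ u} {a ∷ v} () q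
lexLeq-trans {b ∷ u} {b ∷ v} {a ∷ w} p ()

<ˡ⇒≤ˡ : ∀ {u v} → u <ˡ v → u ≤ˡ v
<ˡ⇒≤ˡ {[]} p = refl
<ˡ⇒≤ˡ {_ ∷ _} {[]} ()
<ˡ⇒≤ˡ {a ∷ u} {a ∷ v} p = <ˡ⇒≤ˡ {u} p
<ˡ⇒≤ˡ {a ∷ u} {b ∷ v} p = refl
<ˡ⇒≤ˡ {b ∷ u} {a ∷ v} ()
<ˡ⇒≤ˡ {b ∷ u} {b ∷ v} p = <ˡ⇒≤ˡ {u} p

<ˡ⇒≢ : ∀ {u v} → u <ˡ v → u ≢ v
<ˡ⇒≢ {u} p refl with trans (sym p) (lexLeq-refl u)
... | ()

<ˡ-trans : ∀ {u v w} → u <ˡ v → v <ˡ w → u <ˡ w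
<ˡ-trans {u} {v} {w} p q with lexLeq w u in w≤u
... | false = refl
... | true with trans (sym p) (lexLeq-trans {v} {w} {u} (<ˡ⇒≤ˡ {v} {w} q) w≤u)
...   | ()

lexLeq-total : ∀ u v → u ≤ˡ v ⊎ v ≤ˡ u
lexLeq-total u v with lexLeq u v in u≤v
... | true = inj₁ refl
... | false = inj₂ (<ˡ⇒≤ˡ {v} {u} u≤v)

_≟ᴸ_ : DecidableEquality Letter
a ≟ᴸ a = yes refl
a ≟ᴸ b = no λ ()
b ≟ᴸ a = no λ ()
b ≟ᴸ b = yes refl

lexOrder : DecTotalOrder _ _ _
lexOrder = record
  { Carrier = Word
  ; _≈_ = _≡_
  ; _≤_ = _≤ˡ_
  ; isDecTotalOrder = record
    { isTotalOrder = record
      { isPartialOrder = record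
        { isPreorder = record
          { isEquivalence = isEquivalence
          ; reflexive = λ { {u} refl → lexLeq-refl u }
          ; trans = λ {u} → lexLeq-trans {u}
          }
        ; antisym = lexLeq-antisym
        }
      ; total = lexLeq-total
      }
    ; _≟_ = ≡-dec _≟ᴸ_
    ; _≤?_ = λ u v → lexLeq u v Bool.≟ true
    }
  }

open DecTotalOrder lexOrder using (totalOrder)

insert≡insertionSort-insert : ∀ u vs → insert u vs ≡ InsertionSort.insert lexOrder u vs
insert≡insertionSort-insert u [] = refl
insert≡insertionSort-insert u (v ∷ vs) with lexLeq u v
... | true = refl
... | false = cong (v ∷_) (insert≡insertionSort-insert u vs)

sort≡insertionSort : ∀ us → sort us ≡ InsertionSort.sort lexOrder us
sort≡insertionSort [] = refl
sort≡insertionSort (u ∷ us) rewrite sort≡insertionSort us = insert≡insertionSort-insert u (InsertionSort.sort lexOrder us)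

unique∧⊆∧length⇒↭ : ∀ {xs ys : List A} → Unique xs → xs ⊆ ys → length xs ≡ length ys → xs ↭ ys
unique∧⊆∧length⇒↭ {xs = []} {[]} _ _ _ = ↭-refl
unique∧⊆∧length⇒↭ {xs = x ∷ xs} (x∉xs ∷ xs!) xs⊆ys |xs|≡|ys| with ∈-∃++ (xs⊆ys (here refl))
... | ys₁ , ys₂ , refl = ↭-trans (↭-prep x (unique∧⊆∧length⇒↭ xs! xs⊆ys₁ys₂ |xs|≡|ys₁ys₂|)) (↭-sym (shift x ys₁ ys₂))
  where
  xs⊆ys₁ys₂ : xs ⊆ ys₁ ++ ys₂
  xs⊆ys₁ys₂ y∈xs with ∈-++⁻ ys₁ (xs⊆ys (there y∈xs))
  ... | inj₁ p = ∈-++⁺ˡ p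
  ... | inj₂ (here refl) = ⊥-elim (All.lookup x∉xs y∈xs refl)
  ... | inj₂ (there p) = ∈-++⁺ʳ ys₁ p
  |xs|≡|ys₁ys₂| : length xs ≡ length (ys₁ ++ ys₂)
  |xs|≡|ys₁ys₂| = suc-injective (trans |xs|≡|ys| (length-++-sucʳ ys₁ x ys₂))

sort≡sorted-enumeration : ∀ {xs ys} → AllPairs _<ˡ_ xs → xs ⊆ ys → length xs ≡ length ys → sort ys ≡ xs
sort≡sorted-enumeration {xs} {ys} xs↗ xs⊆ys |xs|≡|ys| = trans (sort≡insertionSort ys)
  (≋⇒≡ (↗↭↗⇒≋ totalOrder (sort-↗ lexOrder ys) xs≤ (↭⇒↭ₛ′ isEquivalence sort-ys↭xs)))
  where
  xs≤ = AllPairs⇒Linked (AllPairs.map (λ {u} {v} → <ˡ⇒≤ˡ {u} {v}) xs↗)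
  sort-ys↭xs = ↭-trans (sort-↭ lexOrder ys) (↭-sym (unique∧⊆∧length⇒↭ (AllPairs.map (λ {u} {v} → <ˡ⇒≢ {u} {v}) xs↗) xs⊆ys |xs|≡|ys|))

-- Ranges of natural numbers

ascending : ℕ → ℕ → List ℕ
ascending lo zero = []
ascending lo (suc d) = lo ∷ ascending (suc lo) d

descending : ℕ → ℕ → List ℕ
descending lo zero = []
descending lo (suc d) = lo + d ∷ descending lo d

applyUpTo-ascending : ∀ (f : ℕ → ℕ) lo d → (∀ i → f i ≡ lo + i) → applyUpTo f d ≡ ascending lo d
applyUpTo-ascending f lo zero f≗ = refl
applyUpTo-ascending f lo (suc d) f≗ = cong₂ _∷_ (trans (f≗ 0) (+-identityʳ lo))
  (applyUpTo-ascending (λ i → f (suc i)) (suc lo) d (λ i → trans (f≗ (suc i)) (+-suc lo i)))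

ascending-++ : ∀ lo m q → ascending lo (m + q) ≡ ascending lo m ++ ascending (lo + m) q
ascending-++ lo zero q = cong (λ l → ascending l q) (sym (+-identityʳ lo))
ascending-++ lo (suc m) q = cong (lo ∷_) (trans (ascending-++ (suc lo) m q) (cong (λ l → ascending (suc lo) m ++ ascending l q) (sym (+-suc lo m))))

descending-++ : ∀ lo m q → descending lo (m + q) ≡ descending (lo + m) q ++ descending lo m
descending-++ lo m zero = cong (descending lo) (+-identityʳ m)
descending-++ lo m (suc q) rewrite +-suc m q = cong₂ _∷_ (sym (+-assoc lo m q)) (descending-++ lo m q)

descending-∷ʳ : ∀ lo d → descending lo (suc d) ≡ descending (suc lo) d ++ lo ∷ []
descending-∷ʳ lo zero = cong (_∷ []) (+-identityʳ lo)
descending-∷ʳ lo (suc d) = cong₂ _∷_ (+-suc lo d) (descending-∷ʳ lo d)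

private
  <-+-suc : ∀ {i} lo d → i < suc lo + d → i < lo + suc d
  <-+-suc {i} lo d = subst (i <_) (sym (+-suc lo d))

  <-+-pred : ∀ {i} lo d → i < lo + d → i < lo + suc d
  <-+-pred lo d i< = <-+-suc lo d (m≤n⇒m≤1+n i<)

  lo<lo+1+d : ∀ lo d → lo < lo + suc d
  lo<lo+1+d lo d = m<m+n lo z<s

  lo+d<lo+1+d : ∀ lo d → lo + d < lo + suc d
  lo+d<lo+1+d lo d = <-+-suc lo d ≤-refl

∈-ascending⁻ : ∀ {i} lo d → i ∈ ascending lo d → lo ≤ i × i < lo + d
∈-ascending⁻ lo (suc d) (here refl) = ≤-refl , lo<lo+1+d lo d
∈-ascending⁻ {i} lo (suc d) (there i∈) with ∈-ascending⁻ (suc lo) d i∈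
... | lo<i , i<lo+d = ≤-trans (n≤1+n lo) lo<i , <-+-suc lo d i<lo+d

∈-descending⁻ : ∀ {i} lo d → i ∈ descending lo d → lo ≤ i × i < lo + d
∈-descending⁻ lo (suc d) (here refl) = m≤m+n lo d , lo+d<lo+1+d lo d
∈-descending⁻ {i} lo (suc d) (there i∈) with ∈-descending⁻ lo d i∈
... | lo≤i , i<lo+d = lo≤i , <-+-pred lo d i<lo+d

∈-ascending⁺ : ∀ {i} lo d → lo ≤ i → i < lo + d → i ∈ ascending lo d
∈-ascending⁺ {i} lo zero lo≤i i<lo+0 = ⊥-elim (<-irrefl refl (≤-<-trans lo≤i (subst (i <_) (+-identityʳ lo) i<lo+0)))
∈-ascending⁺ {i} lo (suc d) lo≤i i<lo+1+d with m≤n⇒m<n∨m≡n lo≤i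
... | inj₁ lo<i = there (∈-ascending⁺ (suc lo) d lo<i (subst (i <_) (+-suc lo d) i<lo+1+d))
... | inj₂ refl = here refl

∈-descending⁺ : ∀ {i} lo d → lo ≤ i → i < lo + d → i ∈ descending lo d
∈-descending⁺ {i} lo zero lo≤i i<lo+0 = ⊥-elim (<-irrefl refl (≤-<-trans lo≤i (subst (i <_) (+-identityʳ lo) i<lo+0)))
∈-descending⁺ {i} lo (suc d) lo≤i i<lo+1+d with m≤n⇒m<n∨m≡n (≤-pred (subst (i <_) (+-suc lo d) i<lo+1+d))
... | inj₁ i<lo+d = there (∈-descending⁺ lo d lo≤i i<lo+d)
... | inj₂ refl = here refl

length-ascending : ∀ lo d → length (ascending lo d) ≡ d
length-ascending lo zero = refl
length-ascending lo (suc d) = cong suc (length-ascending (suc lo) d)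

length-descending : ∀ lo d → length (descending lo d) ≡ d
length-descending lo zero = refl
length-descending lo (suc d) = cong suc (length-descending lo d)

All-ascending : ∀ {P : ℕ → Set} lo d → (∀ {i} → lo ≤ i → i < lo + d → P i) → All P (ascending lo d)
All-ascending lo d P = All.tabulate (λ i∈ → let lo≤i , i<lo+d = ∈-ascending⁻ lo d i∈ in P lo≤i i<lo+d)

All-descending : ∀ {P : ℕ → Set} lo d → (∀ {i} → lo ≤ i → i < lo + d → P i) → All P (descending lo d)
All-descending lo d P = All.tabulate (λ i∈ → let lo≤i , i<lo+d = ∈-descending⁻ lo d i∈ in P lo≤i i<lo+d)

AllPairs-ascending : ∀ {P : ℕ → ℕ → Set} lo d → (∀ {i j} → lo ≤ i → i < j → j < lo + d → P i j) → AllPairs P (ascending lo d)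
AllPairs-ascending lo zero P = []
AllPairs-ascending lo (suc d) P =
  All-ascending (suc lo) d (λ lo<j j< → P ≤-refl lo<j (<-+-suc lo d j<))
  ∷ AllPairs-ascending (suc lo) d (λ lo<i i<j j< → P (≤-trans (n≤1+n lo) lo<i) i<j (<-+-suc lo d j<))

AllPairs-descending : ∀ {P : ℕ → ℕ → Set} lo d → (∀ {i j} → lo ≤ j → j < i → i < lo + d → P i j) → AllPairs P (descending lo d)
AllPairs-descending lo zero P = []
AllPairs-descending lo (suc d) P =
  All-descending lo d (λ lo≤j j<lo+d → P lo≤j j<lo+d (lo+d<lo+1+d lo d))
  ∷ AllPairs-descending lo d (λ lo≤j j<i i< → P lo≤j j<i (<-+-pred lo d i<))

ascending-unique : ∀ lo d → Unique (ascending lo d)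
ascending-unique lo d = AllPairs-ascending lo d (λ _ i<j _ → <⇒≢ i<j)

descending-unique : ∀ lo d → Unique (descending lo d)
descending-unique lo d = AllPairs-descending lo d (λ _ j<i _ → >⇒≢ j<i)

module _ {R : Rel A ℓ} where

  Linked-map-ascending-++ : ∀ (f : ℕ → A) lo d {ys} →
    (∀ {i} → lo ≤ i → suc i < lo + d → R (f i) (f (suc i))) →
    (∀ {i} → lo ≤ i → i < lo + d → Connected R (just (f i)) (head ys)) →
    Linked R ys → Linked R (map f (ascending lo d) ++ ys)
  Linked-map-ascending-++ f lo zero step end ys↗ = ys↗
  Linked-map-ascending-++ f lo (suc zero) step end ys↗ = end ≤-refl (lo<lo+1+d lo 0) ∷′ ys↗
  Linked-map-ascending-++ f lo (suc (suc d)) step end ys↗ =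
    step ≤-refl (<-+-suc lo (suc d) (s≤s (lo<lo+1+d lo d)))
    ∷ Linked-map-ascending-++ f (suc lo) (suc d)
        (λ lo<i i< → step (≤-trans (n≤1+n lo) lo<i) (<-+-suc lo (suc d) i<))
        (λ lo<i i< → end (≤-trans (n≤1+n lo) lo<i) (<-+-suc lo (suc d) i<))
        ys↗

  Linked-map-descending-++ : ∀ (f : ℕ → A) lo d {ys} →
    (∀ {i} → lo ≤ i → suc i < lo + d → R (f (suc i)) (f i)) →
    (∀ {i} → lo ≤ i → i < lo + d → Connected R (just (f i)) (head ys)) →
    Linked R ys → Linked R (map f (descending lo d) ++ ys)
  Linked-map-descending-++ f lo zero step end ys↗ = ys↗
  Linked-map-descending-++ f lo (suc zero) step end ys↗ = end (m≤m+n lo 0) (lo+d<lo+1+d lo 0) ∷′ ys↗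
  Linked-map-descending-++ f lo (suc (suc d)) step end ys↗ =
    subst (λ x → R (f x) (f (lo + d))) (sym (+-suc lo d)) (step (m≤m+n lo d) (<-+-suc lo (suc d) (s≤s (lo+d<lo+1+d lo d))))
    ∷ Linked-map-descending-++ f lo (suc d)
        (λ lo≤i i< → step lo≤i (<-+-pred lo (suc d) i<))
        (λ lo≤i i< → end lo≤i (<-+-pred lo (suc d) i<))
        ys↗

  Linked-pairs-ascending-++ : ∀ (f g : ℕ → A) lo d {ys} →
    (∀ {i} → lo ≤ i → i < lo + d → R (f i) (g i)) →
    (∀ {i} → lo ≤ i → suc i < lo + d → R (g i) (f (suc i))) →
    (∀ {i} → lo ≤ i → i < lo + d → Connected R (just (g i)) (head ys)) →
    Linked R ys → Linked R (concat (map (λ i → f i ∷ g i ∷ []) (ascending lo d)) ++ ys)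
  Linked-pairs-ascending-++ f g lo zero inner step end ys↗ = ys↗
  Linked-pairs-ascending-++ f g lo (suc zero) inner step end ys↗ =
    inner ≤-refl (lo<lo+1+d lo 0) ∷ end ≤-refl (lo<lo+1+d lo 0) ∷′ ys↗
  Linked-pairs-ascending-++ f g lo (suc (suc d)) inner step end ys↗ =
    inner ≤-refl (lo<lo+1+d lo (suc d))
    ∷ step ≤-refl (<-+-suc lo (suc d) (s≤s (lo<lo+1+d lo d)))
    ∷ Linked-pairs-ascending-++ f g (suc lo) (suc d)
        (λ lo<i i< → inner (≤-trans (n≤1+n lo) lo<i) (<-+-suc lo (suc d) i<))
        (λ lo<i i< → step (≤-trans (n≤1+n lo) lo<i) (<-+-suc lo (suc d) i<))
        (λ lo<i i< → end (≤-trans (n≤1+n lo) lo<i) (<-+-suc lo (suc d) i<))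
        ys↗

concat-map-≡[] : ∀ (F : ℕ → List A) {xs} → (∀ {t} → t ∈ xs → F t ≡ []) → concat (map F xs) ≡ []
concat-map-≡[] F {[]} F≡[] = refl
concat-map-≡[] F {x ∷ xs} F≡[] rewrite F≡[] (here refl) = concat-map-≡[] F (λ t∈ → F≡[] (there t∈))

concat-map-select : ∀ (F : ℕ → List A) {t₀ xs} → Unique xs → t₀ ∈ xs →
  (∀ {t} → t ∈ xs → t ≢ t₀ → F t ≡ []) → concat (map F xs) ≡ F t₀
concat-map-select F {xs = x ∷ xs} (x∉xs ∷ _) (here refl) F≡[] =
  trans (cong (F x ++_) (concat-map-≡[] F (λ t∈ → F≡[] (there t∈) (All.lookup x∉xs t∈ ∘ sym)))) (++-identityʳ (F x))
concat-map-select F {xs = x ∷ xs} (x∉xs ∷ xs!) (there t₀∈) F≡[]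
  rewrite F≡[] (here refl) (All.lookup x∉xs t₀∈) = concat-map-select F xs! t₀∈ (λ t∈ → F≡[] (there t∈))

<-+-∸⇒< : ∀ {i lo N} → lo ≤ N → i < lo + (N ∸ lo) → i < N
<-+-∸⇒< {i} lo≤N = subst (i <_) (m+[n∸m]≡n lo≤N)

module _ {R : Rel A ℓ} where

  Connected-head-map-++ : ∀ {x} (f : ℕ → A) xs {y ys} → (∀ i → R x (f i)) → R x y → Connected R (just x) (head (map f xs ++ y ∷ ys))
  Connected-head-map-++ f [] Rf Rxy = just Rxy
  Connected-head-map-++ f (i ∷ xs) Rf Rxy = just (Rf i)

  All-All : ∀ {P Q : A → Set} {xs ys} → (∀ {x y} → P x → Q y → R x y) → All P xs → All Q ys → All (λ x → All (R x) ys) xs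
  All-All PQ⇒R Pxs Qys = All.map (λ Px → All.map (PQ⇒R Px) Qys) Pxs

length-concat-map : ∀ (G : ℕ → List A) xs → length (concat (map G xs)) ≡ sum (map (length ∘ G) xs)
length-concat-map G [] = refl
length-concat-map G (x ∷ xs) = trans (length-++ (G x)) (cong (length (G x) +_) (length-concat-map G xs))

sum-map-linear : ∀ p q xs → sum (map (λ t → p * t + q) xs) ≡ p * sum xs + q * length xs
sum-map-linear p q [] = sym (cong₂ _+_ (*-zeroʳ p) (*-zeroʳ q))
sum-map-linear p q (x ∷ xs) = trans (cong ((p * x + q) +_) (sum-map-linear p q xs)) (lemma p q x (sum xs) (length xs))
  where
  lemma : ∀ p q x s l → (p * x + q) + (p * s + q * l) ≡ p * (x + s) + q * suc l
  lemma = solve-∀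

sum-ascending : ∀ lo d → 2 * sum (ascending lo d) + d ≡ d * (2 * lo + d)
sum-ascending lo zero = refl
sum-ascending lo (suc d) = trans (lemma lo d (sum (ascending (suc lo) d))) (trans (cong (_+ (2 * lo + 1)) (sum-ascending (suc lo) d)) (lemma′ lo d))
  where
  lemma : ∀ lo d s → 2 * (lo + s) + suc d ≡ (2 * s + d) + (2 * lo + 1)
  lemma = solve-∀
  lemma′ : ∀ lo d → d * (2 * suc lo + d) + (2 * lo + 1) ≡ suc d * (2 * lo + suc d)
  lemma′ = solve-∀

sum-descending : ∀ lo d → 2 * sum (descending lo d) + d ≡ d * (2 * lo + d)
sum-descending lo zero = refl
sum-descending lo (suc d) = trans (lemma lo d (sum (descending lo d))) (trans (cong (_+ (2 * lo + 2 * d + 1)) (sum-descending lo d)) (lemma′ lo d))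
  where
  lemma : ∀ lo d s → 2 * (lo + d + s) + suc d ≡ (2 * s + d) + (2 * lo + 2 * d + 1)
  lemma = solve-∀
  lemma′ : ∀ lo d → d * (2 * lo + d) + (2 * lo + 2 * d + 1) ≡ suc d * (2 * lo + suc d)
  lemma′ = solve-∀

map-∸-ascending : ∀ N c lo d → suc N ≡ c + (lo + d) → map (N ∸_) (ascending lo d) ≡ descending c d
map-∸-ascending N c lo zero _ = refl
map-∸-ascending N c lo (suc d) 1+N≡ = cong₂ _∷_ N∸lo≡c+d (map-∸-ascending N c (suc lo) d (trans 1+N≡ (cong (c +_) (+-suc lo d))))
  where
  N∸lo≡c+d : N ∸ lo ≡ c + d
  N∸lo≡c+d = trans (cong (_∸ lo) (suc-injective (trans 1+N≡ (lemma c lo d)))) (m+n∸m≡n lo (c + d))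
    where
    lemma : ∀ c lo d → c + (lo + suc d) ≡ suc (lo + (c + d))
    lemma = solve-∀

map-∸-descending : ∀ N c lo d → suc N ≡ c + (lo + d) → map (N ∸_) (descending lo d) ≡ ascending c d
map-∸-descending N c lo zero _ = refl
map-∸-descending N c lo (suc d) 1+N≡ = cong₂ _∷_ N∸[lo+d]≡c (map-∸-descending N (suc c) lo d (trans 1+N≡ (lemma c lo d)))
  where
  lemma : ∀ c lo d → c + (lo + suc d) ≡ suc c + (lo + d)
  lemma = solve-∀
  lemma′ : ∀ c lo d → c + (lo + suc d) ≡ suc ((lo + d) + c)
  lemma′ = solve-∀
  N∸[lo+d]≡c : N ∸ (lo + d) ≡ c
  N∸[lo+d]≡c = trans (cong (_∸ (lo + d)) (suc-injective (trans 1+N≡ (lemma′ c lo d)))) (m+n∸m≡n (lo + d) c)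

length-concat-map-pairs : ∀ (f g : ℕ → A) xs → length (concat (map (λ i → f i ∷ g i ∷ []) xs)) ≡ 2 * length xs
length-concat-map-pairs f g [] = refl
length-concat-map-pairs f g (x ∷ xs) = trans (cong (2 +_) (length-concat-map-pairs f g xs)) (sym (*-suc 2 (length xs)))

length-map-ascending : ∀ (f : ℕ → A) lo d → length (map f (ascending lo d)) ≡ d
length-map-ascending f lo d = trans (length-map f (ascending lo d)) (length-ascending lo d)

length-map-descending : ∀ (f : ℕ → A) lo d → length (map f (descending lo d)) ≡ d
length-map-descending f lo d = trans (length-map f (descending lo d)) (length-descending lo d)

filter-concat-map : ∀ {P : A → Set} (P? : Decidable P) (G : ℕ → List A) xs →
  filter P? (concat (map G xs)) ≡ concat (map (filter P? ∘ G) xs)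
filter-concat-map P? G [] = refl
filter-concat-map P? G (x ∷ xs) = trans (filter-++ P? (G x) _) (cong (filter P? (G x) ++_) (filter-concat-map P? G xs))

map-concat-map : ∀ {B : Set} (f : A → B) (G : ℕ → List A) xs → map f (concat (map G xs)) ≡ concat (map (map f ∘ G) xs)
map-concat-map f G [] = refl
map-concat-map f G (x ∷ xs) = trans (map-++ f (G x) _) (cong (map f (G x) ++_) (map-concat-map f G xs))

concat-++ʳ : ∀ (xss : List (List A)) ys → concat xss ++ ys ≡ foldr _++_ ys xss
concat-++ʳ [] ys = refl
concat-++ʳ (xs ∷ xss) ys = trans (++-assoc xs (concat xss) ys) (cong (xs ++_) (concat-++ʳ xss ys))

module _ {B : Set} where

  map-ascending-replicate : ∀ (f : ℕ → B) lo d {c} → (∀ {i} → lo ≤ i → i < lo + d → f i ≡ c) → map f (ascending lo d) ≡ replicate d c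
  map-ascending-replicate f lo zero f≡c = refl
  map-ascending-replicate f lo (suc d) f≡c = cong₂ _∷_ (f≡c ≤-refl (lo<lo+1+d lo d))
    (map-ascending-replicate f (suc lo) d (λ lo<i i< → f≡c (≤-trans (n≤1+n lo) lo<i) (<-+-suc lo d i<)))

  map-descending-replicate : ∀ (f : ℕ → B) lo d {c} → (∀ {i} → lo ≤ i → i < lo + d → f i ≡ c) → map f (descending lo d) ≡ replicate d c
  map-descending-replicate f lo zero f≡c = refl
  map-descending-replicate f lo (suc d) f≡c = cong₂ _∷_ (f≡c (m≤m+n lo d) (lo+d<lo+1+d lo d))
    (map-descending-replicate f lo d (λ lo≤i i< → f≡c lo≤i (<-+-pred lo d i<)))

  concat-map-pairs-replicate : ∀ (f g : ℕ → B) lo d {c c'} → (∀ {i} → lo ≤ i → i < lo + d → f i ≡ c) → (∀ {i} → lo ≤ i → i < lo + d → g i ≡ c') →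
    concat (map (λ i → f i ∷ g i ∷ []) (ascending lo d)) ≡ concat (replicate d (c ∷ c' ∷ []))
  concat-map-pairs-replicate f g lo zero f≡c g≡c' = refl
  concat-map-pairs-replicate f g lo (suc d) {c} {c'} f≡c g≡c' = trans
    (cong₂ (λ x y → x ∷ y ∷ concat (map (λ i → f i ∷ g i ∷ []) (ascending (suc lo) d))) (f≡c ≤-refl (lo<lo+1+d lo d)) (g≡c' ≤-refl (lo<lo+1+d lo d)))
    (cong (λ xs → c ∷ c' ∷ xs) (concat-map-pairs-replicate f g (suc lo) d
      (λ lo<i i< → f≡c (≤-trans (n≤1+n lo) lo<i) (<-+-suc lo d i<)) (λ lo<i i< → g≡c' (≤-trans (n≤1+n lo) lo<i) (<-+-suc lo d i<))))

-- Words over {a, b}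

^-+ : ∀ (c : Letter) m n → c ^ (m + n) ≡ c ^ m ++ c ^ n
^-+ c zero n = refl
^-+ c (suc m) n = cong (c ∷_) (^-+ c m n)

^-∸ : ∀ (c : Letter) {m j} → j ≤ m → c ^ m ≡ c ^ (m ∸ j) ++ c ^ j
^-∸ c {m} {j} j≤m = trans (cong (c ^_) (sym (m∸n+n≡m j≤m))) (^-+ c (m ∸ j) j)

^-++-∷ : ∀ (c : Letter) m u → c ^ m ++ c ∷ u ≡ c ∷ c ^ m ++ u
^-++-∷ c zero u = refl
^-++-∷ c (suc m) u = cong (c ∷_) (^-++-∷ c m u)

lexLeq-++ˡ : ∀ x u v → lexLeq (x ++ u) (x ++ v) ≡ lexLeq u v
lexLeq-++ˡ [] u v = refl
lexLeq-++ˡ (a ∷ x) u v = lexLeq-++ˡ x u v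
lexLeq-++ˡ (b ∷ x) u v = lexLeq-++ˡ x u v

<ˡ-++ˡ : ∀ x {u v} → u <ˡ v → (x ++ u) <ˡ (x ++ v)
<ˡ-++ˡ x {u} {v} u<v = trans (lexLeq-++ˡ x v u) u<v

fewer-b-<ˡ : ∀ {j j'} u v → j < j' → (b ^ j ++ a ∷ u) <ˡ (b ^ j' ++ v)
fewer-b-<ˡ {zero} {suc j'} u v _ = refl
fewer-b-<ˡ {suc j} {suc j'} u v (s≤s j<j') = fewer-b-<ˡ u v j<j'

more-a-<ˡ : ∀ {m m'} u v → m < m' → (a ^ m' ++ v) <ˡ (a ^ m ++ b ∷ u)
more-a-<ˡ {zero} {suc m'} u v _ = refl
more-a-<ˡ {suc m} {suc m'} u v (s≤s m<m') = more-a-<ˡ u v m<m'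

lastOr : Letter → Word → Letter
lastOr = foldl (λ _ c → c)

lastChar≡lastOr : ∀ u → lastChar u ≡ lastOr a u
lastChar≡lastOr [] = refl
lastChar≡lastOr (c ∷ []) = refl
lastChar≡lastOr (c ∷ d ∷ u) = lastChar≡lastOr (d ∷ u)

lastOr-++ : ∀ c u v → lastOr c (u ++ v) ≡ lastOr (lastOr c u) v
lastOr-++ = foldl-++ (λ _ c → c)

lastOr-^-self : ∀ c m → lastOr c (c ^ m) ≡ c
lastOr-^-self c zero = refl
lastOr-^-self c (suc m) = lastOr-^-self c m

lastOr-^ : ∀ c d m → lastOr c (d ^ suc m) ≡ d
lastOr-^ c d m = lastOr-^-self d m

rotation∈conjugates : ∀ c u v → v ++ c ∷ u ∈ conjugates (c ∷ u ++ v)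
rotation∈conjugates c u [] = here (sym (trans (++-identityʳ (c ∷ u ++ [])) (cong (c ∷_) (++-identityʳ u))))
rotation∈conjugates c u (d ∷ v) = subst (_∈ conjugates cudv) (cong₂ _++_ (drop-length-++ (c ∷ u)) (take-length-++ (c ∷ u)))
  (∈-applyUpTo⁺ (λ i → rotate i cudv) (length<length-++-∷ (c ∷ u)))
  where
  cudv = c ∷ u ++ d ∷ v
  drop-length-++ : ∀ x → drop (length x) (x ++ d ∷ v) ≡ d ∷ v
  drop-length-++ [] = refl
  drop-length-++ (_ ∷ x) = drop-length-++ x
  take-length-++ : ∀ x → take (length x) (x ++ d ∷ v) ≡ x
  take-length-++ [] = refl
  take-length-++ (e ∷ x) = cong (e ∷_) (take-length-++ x)
  length<length-++-∷ : ∀ x → length x < length (x ++ d ∷ v)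
  length<length-++-∷ [] = z<s
  length<length-++-∷ (_ ∷ x) = s≤s (length<length-++-∷ x)

++-assoc₃ : ∀ (u v w t : Word) → (u ++ v ++ w) ++ t ≡ u ++ v ++ w ++ t
++-assoc₃ u v w t = trans (++-assoc u (v ++ w) t) (cong (u ++_) (++-assoc v w t))

StartsAᵐb : ℕ → Word → Set
StartsAᵐb m u = ∃[ z ] u ≡ a ^ m ++ b ∷ z

StartsBʲa : ℕ → Word → Set
StartsBʲa j u = ∃[ z ] u ≡ b ^ j ++ a ∷ z

StartsAᵐb-<ˡ : ∀ {m m' u v} → m' < m → StartsAᵐb m u → StartsAᵐb m' v → u <ˡ v
StartsAᵐb-<ˡ m'<m (z , refl) (z' , refl) = more-a-<ˡ z' (b ∷ z) m'<m

StartsBʲa-<ˡ : ∀ {j j' u v} → j < j' → StartsBʲa j u → StartsBʲa j' v → u <ˡ v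
StartsBʲa-<ˡ j<j' (z , refl) (z' , refl) = fewer-b-<ˡ z (a ∷ z') j<j'

StartsAᵐb-<ˡ-StartsBʲa : ∀ {m j u v} → StartsAᵐb (suc m) u → StartsBʲa (suc j) v → u <ˡ v
StartsAᵐb-<ˡ-StartsBʲa (z , refl) (z' , refl) = refl

isPrefix-aᵐb : ∀ {m u} → StartsAᵐb m u → isPrefix (a ^ m ++ b ∷ []) u ≡ true
isPrefix-aᵐb {zero} (z , refl) = refl
isPrefix-aᵐb {suc m} (z , refl) = isPrefix-aᵐb {m} (z , refl)

isPrefix-bʲa : ∀ {j u} → StartsBʲa j u → isPrefix (b ^ j ++ a ∷ []) u ≡ true
isPrefix-bʲa {zero} (z , refl) = refl
isPrefix-bʲa {suc j} (z , refl) = isPrefix-bʲa {j} (z , refl)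

¬isPrefix-aᵐb : ∀ {i m u} → i ≢ m → StartsAᵐb m u → isPrefix (a ^ i ++ b ∷ []) u ≢ true
¬isPrefix-aᵐb {zero} {zero} i≢m _ = ⊥-elim (i≢m refl)
¬isPrefix-aᵐb {zero} {suc m} _ (z , refl) ()
¬isPrefix-aᵐb {suc i} {zero} _ (z , refl) ()
¬isPrefix-aᵐb {suc i} {suc m} i≢m (z , refl) = ¬isPrefix-aᵐb (i≢m ∘ cong suc) (z , refl)

¬isPrefix-bʲa : ∀ {i j u} → i ≢ j → StartsBʲa j u → isPrefix (b ^ i ++ a ∷ []) u ≢ true
¬isPrefix-bʲa {zero} {zero} i≢j _ = ⊥-elim (i≢j refl)
¬isPrefix-bʲa {zero} {suc j} _ (z , refl) ()
¬isPrefix-bʲa {suc i} {zero} _ (z , refl) ()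
¬isPrefix-bʲa {suc i} {suc j} i≢j (z , refl) = ¬isPrefix-bʲa (i≢j ∘ cong suc) (z , refl)

¬isPrefix-aᵐb-bʲa : ∀ {i j u} → StartsBʲa (suc j) u → isPrefix (a ^ suc i ++ b ∷ []) u ≢ true
¬isPrefix-aᵐb-bʲa (z , refl) ()

¬isPrefix-bʲa-aᵐb : ∀ {i m u} → StartsAᵐb (suc m) u → isPrefix (b ^ suc i ++ a ∷ []) u ≢ true
¬isPrefix-bʲa-aᵐb (z , refl) ()

lastOr-++-∷ : ∀ c u d v → lastOr c (u ++ d ∷ v) ≡ lastOr d v
lastOr-++-∷ c u d v = lastOr-++ c u (d ∷ v)

lastOr-^-∸ : ∀ c d {i j} → j < i → lastOr c (d ^ (i ∸ j)) ≡ d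
lastOr-^-∸ c d {suc i} {zero} _ = lastOr-^ c d i
lastOr-^-∸ c d {suc i} {suc j} (s≤s j<i) = lastOr-^-∸ c d j<i

ba^ʷ-suc : ∀ m → (b ∷ a ∷ []) ^ʷ suc m ≡ b ∷ (a ∷ b ∷ []) ^ʷ m ++ a ∷ []
ba^ʷ-suc zero = refl
ba^ʷ-suc (suc m) = cong (λ w → b ∷ a ∷ w) (ba^ʷ-suc m)

aa^ʷ : ∀ m → (a ∷ a ∷ []) ^ʷ m ≡ a ^ (m + m)
aa^ʷ zero = refl
aa^ʷ (suc m) = cong (a ∷_) (trans (cong (a ∷_) (aa^ʷ m)) (cong (a ^_) (sym (+-suc m m))))

runsFrom-++ : ∀ p u v → runsFrom p (u ++ v) ≡ runsFrom p u + runsFrom (lastOr p u) v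
runsFrom-++ p [] v = refl
runsFrom-++ a (a ∷ u) v = runsFrom-++ a u v
runsFrom-++ a (b ∷ u) v = cong suc (runsFrom-++ b u v)
runsFrom-++ b (a ∷ u) v = cong suc (runsFrom-++ a u v)
runsFrom-++ b (b ∷ u) v = runsFrom-++ b u v

runsFrom-++-piece : ∀ {c q} p u v → runsFrom p u ≡ c → lastOr p u ≡ q → runsFrom p (u ++ v) ≡ c + runsFrom q v
runsFrom-++-piece p u v runs≡c last≡q = trans (runsFrom-++ p u v) (cong₂ (λ x y → x + runsFrom y v) runs≡c last≡q)

runsFrom-^ : ∀ c m v → runsFrom c (c ^ m ++ v) ≡ runsFrom c v
runsFrom-^ c zero v = refl
runsFrom-^ a (suc m) v = runsFrom-^ a m v
runsFrom-^ b (suc m) v = runsFrom-^ b m v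

runsFrom-^-self : ∀ c m → runsFrom c (c ^ m) ≡ 0
runsFrom-^-self c m = trans (cong (runsFrom c) (sym (++-identityʳ (c ^ m)))) (runsFrom-^ c m [])

runsFrom-ab^ʷ : ∀ m v → runsFrom b ((a ∷ b ∷ []) ^ʷ m ++ v) ≡ 2 * m + runsFrom b v
runsFrom-ab^ʷ zero v = refl
runsFrom-ab^ʷ (suc m) v = trans (cong (2 +_) (runsFrom-ab^ʷ m v)) (cong (_+ runsFrom b v) (sym (*-suc 2 m)))

-- The blocks of ŵ_k

block : ℕ → Word
block i = b ^ i ++ a ∷ a ∷ a ∷ b ^ i ++ a ∷ b ∷ a ^ (i ∸ 1)

blocks : ℕ → ℕ → Word
blocks lo d = concat (map block (ascending lo d))

block-++ : ∀ i t → block i ++ t ≡ b ^ i ++ a ∷ a ∷ a ∷ b ^ i ++ a ∷ b ∷ a ^ (i ∸ 1) ++ t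
block-++ i = ++-assoc₃ (b ^ i) (a ∷ a ∷ a ∷ b ^ i) (a ∷ b ∷ a ^ (i ∸ 1))

blocks-++ : ∀ lo m q → blocks lo (m + q) ≡ blocks lo m ++ blocks (lo + m) q
blocks-++ lo m q = begin
  concat (map block (ascending lo (m + q)))                          ≡⟨ cong (concat ∘ map block) (ascending-++ lo m q) ⟩
  concat (map block (ascending lo m ++ ascending (lo + m) q))        ≡⟨ cong concat (map-++ block (ascending lo m) _) ⟩
  concat (map block (ascending lo m) ++ map block (ascending (lo + m) q)) ≡⟨ concat-++ (map block (ascending lo m)) _ ⟨
  blocks lo m ++ blocks (lo + m) q                                   ∎

-- Written exactly as the factor in the definition of w, so that ŵ≡ can unfold w.
factor : ℕ → Word
factor i = (a ∷ []) ++ (b ^ i) ++ (a ∷ a ∷ []) ++ (a ∷ []) ++ (b ^ i) ++ (a ∷ b ∷ []) ++ (a ^ (i ∸ 2))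

factor-++ : ∀ p t → factor (2 + p) ++ a ∷ t ≡ a ∷ block (2 + p) ++ t
factor-++ p t = cong (a ∷_) (begin
  (b ^ i ++ a ∷ a ∷ a ∷ b ^ i ++ a ∷ b ∷ a ^ p) ++ a ∷ t ≡⟨ ++-assoc (b ^ i) _ (a ∷ t) ⟩
  b ^ i ++ a ∷ a ∷ a ∷ (b ^ i ++ a ∷ b ∷ a ^ p) ++ a ∷ t ≡⟨ cong (λ z → b ^ i ++ a ∷ a ∷ a ∷ z) (++-assoc (b ^ i) _ (a ∷ t)) ⟩
  b ^ i ++ a ∷ a ∷ a ∷ b ^ i ++ a ∷ b ∷ a ^ p ++ a ∷ t ≡⟨ cong (λ z → b ^ i ++ a ∷ a ∷ a ∷ b ^ i ++ a ∷ b ∷ z) (^-++-∷ a p t) ⟩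
  b ^ i ++ a ∷ a ∷ a ∷ b ^ i ++ a ∷ b ∷ a ^ suc p ++ t ≡⟨ block-++ i t ⟨
  block i ++ t ∎)
  where
  i = 2 + p

factors-++ : ∀ p d t → concat (map factor (ascending (2 + p) d)) ++ a ∷ t ≡ a ∷ blocks (2 + p) d ++ t
factors-++ p zero t = refl
factors-++ p (suc d) t = begin
  (factor lo ++ concat (map factor (ascending (suc lo) d))) ++ a ∷ t ≡⟨ ++-assoc (factor lo) _ (a ∷ t) ⟩
  factor lo ++ concat (map factor (ascending (suc lo) d)) ++ a ∷ t ≡⟨ cong (factor lo ++_) (factors-++ (suc p) d t) ⟩
  factor lo ++ a ∷ blocks (suc lo) d ++ t                            ≡⟨ factor-++ p (blocks (suc lo) d ++ t) ⟩
  a ∷ block lo ++ blocks (suc lo) d ++ t                             ≡⟨ cong (a ∷_) (++-assoc (block lo) _ t) ⟨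
  a ∷ (block lo ++ blocks (suc lo) d) ++ t                           ∎
  where
  lo = 2 + p

dropLast-∷ʳ : ∀ u (c : Letter) → dropLast (u ++ c ∷ []) ≡ u
dropLast-∷ʳ [] c = refl
dropLast-∷ʳ (x ∷ []) c = refl
dropLast-∷ʳ (x ∷ y ∷ u) c = cong (x ∷_) (dropLast-∷ʳ (y ∷ u) c)

dropLast-++-∷ʳ : ∀ u v (c : Letter) → dropLast (u ++ v ++ c ∷ []) ≡ u ++ v
dropLast-++-∷ʳ u v c = trans (cong dropLast (sym (++-assoc u v (c ∷ [])))) (dropLast-∷ʳ (u ++ v) c)

lastOr-block : ∀ c p → lastOr c (block (2 + p)) ≡ a
lastOr-block c p = begin
  lastOr c (b ^ i ++ a ∷ a ∷ a ∷ b ^ i ++ a ∷ b ∷ a ∷ a ^ p) ≡⟨ lastOr-++ c (b ^ i) _ ⟩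
  lastOr a (b ^ i ++ a ∷ b ∷ a ∷ a ^ p)                     ≡⟨ lastOr-++ a (b ^ i) _ ⟩
  lastOr a (a ^ p)                                          ≡⟨ lastOr-^-self a p ⟩
  a ∎
  where
  i = 2 + p

lastOr-blocks : ∀ p d → lastOr a (blocks (2 + p) d) ≡ a
lastOr-blocks p zero = refl
lastOr-blocks p (suc d) = begin
  lastOr a (block (2 + p) ++ blocks (3 + p) d)    ≡⟨ lastOr-++ a (block (2 + p)) _ ⟩
  lastOr (lastOr a (block (2 + p))) (blocks (3 + p) d) ≡⟨ cong (λ c → lastOr c (blocks (3 + p) d)) (lastOr-block a p) ⟩
  lastOr a (blocks (3 + p) d)                      ≡⟨ lastOr-blocks (suc p) d ⟩
  a ∎

module WordStructure (n : ℕ) where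

  k : ℕ
  k = 6 + n

  ŵ≡ : ŵ k ≡ a ∷ blocks 2 (4 + n) ++ b ^ k
  ŵ≡ = begin
    ŵ k                                                    ≡⟨ dropLast-++-∷ʳ P (a ∷ b ^ k) a ⟩
    P ++ a ∷ b ^ k                                         ≡⟨ cong (λ is → concat (map factor is) ++ a ∷ b ^ k) (applyUpTo-ascending (2 +_) 2 (4 + n) (λ _ → refl)) ⟩
    concat (map factor (ascending 2 (4 + n))) ++ a ∷ b ^ k ≡⟨ factors-++ 0 (4 + n) (b ^ k) ⟩
    a ∷ blocks 2 (4 + n) ++ b ^ k                          ∎
    where P = prod 2 (5 + n) factor

  before : ℕ → Word
  before i = blocks 2 (i ∸ 2)

  after : ℕ → Word
  after i = blocks (suc i) (5 + n ∸ i) ++ b ^ k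

  -- The rest of the cyclic word ŵ k after block i: the conjugate starting inside
  -- block i = x ++ y, right before y, is rotation i x y.
  complement : ℕ → Word
  complement i = after i ++ a ∷ before i

  ŵ-around : ∀ {i} → 2 ≤ i → i ≤ 5 + n → ŵ k ≡ a ∷ before i ++ block i ++ after i
  ŵ-around {suc (suc p)} (s≤s (s≤s z≤n)) (s≤s (s≤s p≤3+n)) = begin
    ŵ k                                                   ≡⟨ ŵ≡ ⟩
    a ∷ blocks 2 (4 + n) ++ b ^ k                         ≡⟨ cong (λ d → a ∷ blocks 2 d ++ b ^ k) 4+n≡p+1+q ⟩
    a ∷ blocks 2 (p + suc q) ++ b ^ k                     ≡⟨ cong (λ z → a ∷ z ++ b ^ k) (blocks-++ 2 p (suc q)) ⟩
    a ∷ (blocks 2 p ++ block i ++ blocks (suc i) q) ++ b ^ k ≡⟨ cong (a ∷_) (++-assoc (blocks 2 p) _ (b ^ k)) ⟩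
    a ∷ blocks 2 p ++ (block i ++ blocks (suc i) q) ++ b ^ k ≡⟨ cong (λ z → a ∷ blocks 2 p ++ z) (++-assoc (block i) _ (b ^ k)) ⟩
    a ∷ before i ++ block i ++ after i                    ∎
    where
    i = 2 + p
    q = 3 + n ∸ p
    4+n≡p+1+q : 4 + n ≡ p + suc q
    4+n≡p+1+q = sym (trans (+-suc p q) (cong suc (m+[n∸m]≡n p≤3+n)))

  rotation : ℕ → Word → Word → Word
  rotation i x y = y ++ complement i ++ x

  rotation∈conjugates-ŵ : ∀ {i} → 2 ≤ i → i ≤ 5 + n → ∀ x y → block i ≡ x ++ y → rotation i x y ∈ conjugates (ŵ k)
  rotation∈conjugates-ŵ {i} 2≤i i≤5+n x y block≡x++y =
    subst₂ (λ u v → u ∈ conjugates v) rotated split (rotation∈conjugates a (before i ++ x) (y ++ after i))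
    where
    split : (a ∷ before i ++ x) ++ y ++ after i ≡ ŵ k
    split = sym (begin
      ŵ k                                    ≡⟨ ŵ-around 2≤i i≤5+n ⟩
      a ∷ before i ++ block i ++ after i     ≡⟨ cong (λ z → a ∷ before i ++ z ++ after i) block≡x++y ⟩
      a ∷ before i ++ (x ++ y) ++ after i    ≡⟨ cong (λ z → a ∷ before i ++ z) (++-assoc x y (after i)) ⟩
      a ∷ before i ++ x ++ y ++ after i      ≡⟨ cong (a ∷_) (++-assoc (before i) x _) ⟨
      (a ∷ before i ++ x) ++ y ++ after i    ∎)
    rotated : (y ++ after i) ++ a ∷ before i ++ x ≡ rotation i x y
    rotated = trans (++-assoc y (after i) _) (cong (y ++_) (sym (++-assoc (after i) (a ∷ before i) x)))

  tailRotation : ℕ → Word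
  tailRotation j = b ^ j ++ a ∷ blocks 2 (4 + n) ++ b ^ (k ∸ j)

  tailRotation∈conjugates-ŵ : ∀ {j} → j ≤ k → tailRotation j ∈ conjugates (ŵ k)
  tailRotation∈conjugates-ŵ {j} j≤k =
    subst (λ v → tailRotation j ∈ conjugates v) split (rotation∈conjugates a (B ++ b ^ (k ∸ j)) (b ^ j))
    where
    B = blocks 2 (4 + n)
    split : (a ∷ B ++ b ^ (k ∸ j)) ++ b ^ j ≡ ŵ k
    split = sym (trans ŵ≡ (cong (a ∷_) (trans (cong (B ++_) (^-∸ b j≤k)) (sym (++-assoc B _ _)))))

  after-< : ∀ {i} → i ≤ 4 + n → after i ≡ block (suc i) ++ blocks (2 + i) (4 + n ∸ i) ++ b ^ k
  after-< {i} i≤4+n = begin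
    blocks (suc i) (5 + n ∸ i) ++ b ^ k                  ≡⟨ cong (λ d → blocks (suc i) d ++ b ^ k) (+-∸-assoc 1 i≤4+n) ⟩
    (block (suc i) ++ blocks (2 + i) (4 + n ∸ i)) ++ b ^ k ≡⟨ ++-assoc (block (suc i)) _ _ ⟩
    block (suc i) ++ blocks (2 + i) (4 + n ∸ i) ++ b ^ k ∎

  after-last : after (5 + n) ≡ b ^ k
  after-last = cong (λ d → blocks (6 + n) d ++ b ^ k) (n∸n≡0 n)

  complement-b^aa : ∀ {i} → i ≤ 4 + n → ∀ t → ∃[ z ] complement i ++ t ≡ b ^ suc i ++ a ∷ a ∷ z
  complement-b^aa {i} i≤4+n t = _ , (begin
    (after i ++ a ∷ before i) ++ t                 ≡⟨ ++-assoc (after i) _ t ⟩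
    after i ++ a ∷ before i ++ t                   ≡⟨ cong (_++ a ∷ before i ++ t) (after-< i≤4+n) ⟩
    (block (suc i) ++ R) ++ a ∷ before i ++ t      ≡⟨ ++-assoc (block (suc i)) R _ ⟩
    block (suc i) ++ R ++ a ∷ before i ++ t        ≡⟨ block-++ (suc i) _ ⟩
    b ^ suc i ++ a ∷ a ∷ a ∷ b ^ suc i ++ a ∷ b ∷ a ^ i ++ R ++ a ∷ before i ++ t ∎)
    where R = blocks (2 + i) (4 + n ∸ i) ++ b ^ k

  complement-b^a : ∀ {i} → i ≤ 5 + n → ∀ t → ∃[ z ] complement i ++ t ≡ b ^ suc i ++ a ∷ z
  complement-b^a i≤5+n t with m≤n⇒m<n∨m≡n i≤5+n
  ... | inj₁ (s≤s i≤4+n) = let z , eq = complement-b^aa i≤4+n t in a ∷ z , eq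
  ... | inj₂ refl = _ , trans (++-assoc (after (5 + n)) _ t) (cong (_++ a ∷ before (5 + n) ++ t) after-last)

  lastChar-rotation : ∀ i x y → lastChar (rotation i x y) ≡ lastOr a x
  lastChar-rotation i x y = begin
    lastChar (y ++ complement i ++ x)               ≡⟨ lastChar≡lastOr (y ++ complement i ++ x) ⟩
    lastOr a (y ++ complement i ++ x)               ≡⟨ lastOr-++ a y _ ⟩
    lastOr c (complement i ++ x)                    ≡⟨ lastOr-++ c (complement i) x ⟩
    lastOr (lastOr c (complement i)) x              ≡⟨ cong (λ c → lastOr c x) (trans (lastOr-++ c (after i) _) (lastOr-blocks 0 (i ∸ 2))) ⟩
    lastOr a x                                      ∎
    where c = lastOr a y

  lastChar-tailRotation : ∀ j → lastChar (tailRotation j) ≡ lastOr a (b ^ (k ∸ j))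
  lastChar-tailRotation j = begin
    lastChar (tailRotation j)                         ≡⟨ lastChar≡lastOr (tailRotation j) ⟩
    lastOr a (b ^ j ++ a ∷ B ++ b ^ (k ∸ j))          ≡⟨ lastOr-++ a (b ^ j) _ ⟩
    lastOr a (B ++ b ^ (k ∸ j))                       ≡⟨ lastOr-++ a B _ ⟩
    lastOr (lastOr a B) (b ^ (k ∸ j))                 ≡⟨ cong (λ c → lastOr c (b ^ (k ∸ j))) (lastOr-blocks 0 (4 + n)) ⟩
    lastOr a (b ^ (k ∸ j))                            ∎
    where B = blocks 2 (4 + n)

  b^a<ˡcomplement : ∀ {i i'} u t → i' ≤ i → i ≤ 5 + n → (b ^ i' ++ a ∷ u) <ˡ (complement i ++ t)
  b^a<ˡcomplement {i} u t i'≤i i≤5+n with complement-b^a i≤5+n t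
  ... | z , eq rewrite eq = fewer-b-<ˡ u (a ∷ z) (s≤s i'≤i)

  complement<ˡb^ab : ∀ {i} t u → i ≤ 4 + n → (complement i ++ t) <ˡ (b ^ suc i ++ a ∷ b ∷ u)
  complement<ˡb^ab {i} t u i≤4+n with complement-b^aa i≤4+n t
  ... | z , eq rewrite eq = <ˡ-++ˡ (b ^ suc i) {a ∷ a ∷ z} {a ∷ b ∷ u} refl

  complement<ˡcomplement : ∀ {i i'} t t' → i < i' → i' ≤ 5 + n → (complement i ++ t) <ˡ (complement i' ++ t')
  complement<ˡcomplement {i} t t' i<i' i'≤5+n with complement-b^a (≤-trans (n≤1+n i) (≤-trans i<i' i'≤5+n)) t
  ... | z , eq rewrite eq = b^a<ˡcomplement z t' i<i' i'≤5+n

  more-a<ˡcomplement : ∀ {i} m v t → i ≤ 5 + n → (a ^ suc m ++ v) <ˡ (a ^ m ++ complement i ++ t)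
  more-a<ˡcomplement {i} m v t i≤5+n with complement-b^a i≤5+n t
  ... | z , eq rewrite eq = more-a-<ˡ {m} (b ^ i ++ a ∷ z) v ≤-refl

  complement-StartsB : ∀ {i} m t → i ≤ 5 + n → StartsAᵐb m (a ^ m ++ complement i ++ t)
  complement-StartsB {i} m t i≤5+n with complement-b^a i≤5+n t
  ... | z , eq = b ^ i ++ a ∷ z , cong (a ^ m ++_) eq

module BlockRotations (n : ℕ) where

  open WordStructure n

  -- rotᵣ i j starts in the r-th letter run of block i (the runs b^i, aaa, b^i, a, b, a^(i-1))
  -- with j letters of that run left; tailRotation j starts in the final run b^k with j letters
  -- left, so tailRotation 0 is ŵ k itself.
  rot₁ rot₂ rot₃ rot₆ : ℕ → ℕ → Word
  rot₁ i j = b ^ j ++ a ∷ a ∷ a ∷ b ^ i ++ a ∷ b ∷ a ^ (i ∸ 1) ++ complement i ++ b ^ (i ∸ j)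
  rot₂ i m = a ^ m ++ b ^ i ++ a ∷ b ∷ a ^ (i ∸ 1) ++ complement i ++ b ^ i ++ a ^ (3 ∸ m)
  rot₃ i j = b ^ j ++ a ∷ b ∷ a ^ (i ∸ 1) ++ complement i ++ b ^ i ++ a ∷ a ∷ a ∷ b ^ (i ∸ j)
  rot₆ i m = a ^ m ++ complement i ++ b ^ i ++ a ∷ a ∷ a ∷ b ^ i ++ a ∷ b ∷ a ^ (i ∸ 1 ∸ m)

  rot₄ rot₅ : ℕ → Word
  rot₄ i = a ∷ b ∷ a ^ (i ∸ 1) ++ complement i ++ b ^ i ++ a ∷ a ∷ a ∷ b ^ i
  rot₅ i = b ∷ a ^ (i ∸ 1) ++ complement i ++ b ^ i ++ a ∷ a ∷ a ∷ b ^ i ++ a ∷ []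

  rot₁≡rotation : ∀ i j → rot₁ i j ≡ rotation i (b ^ (i ∸ j)) (b ^ j ++ a ∷ a ∷ a ∷ b ^ i ++ a ∷ b ∷ a ^ (i ∸ 1))
  rot₁≡rotation i j = sym (++-assoc₃ (b ^ j) (a ∷ a ∷ a ∷ b ^ i) (a ∷ b ∷ a ^ (i ∸ 1)) _)

  rot₂≡rotation : ∀ i m → rot₂ i m ≡ rotation i (b ^ i ++ a ^ (3 ∸ m)) (a ^ m ++ b ^ i ++ a ∷ b ∷ a ^ (i ∸ 1))
  rot₂≡rotation i m = sym (++-assoc₃ (a ^ m) (b ^ i) (a ∷ b ∷ a ^ (i ∸ 1)) _)

  rot₃≡rotation : ∀ i j → rot₃ i j ≡ rotation i (b ^ i ++ a ∷ a ∷ a ∷ b ^ (i ∸ j)) (b ^ j ++ a ∷ b ∷ a ^ (i ∸ 1))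
  rot₃≡rotation i j = sym (++-assoc (b ^ j) (a ∷ b ∷ a ^ (i ∸ 1)) _)

  module _ {i} (2≤i : 2 ≤ i) (i≤5+n : i ≤ 5 + n) where

    private
      C = conjugates (ŵ k)
      rotation∈ = rotation∈conjugates-ŵ 2≤i i≤5+n

    rot₁∈conjugates : ∀ {j} → j ≤ i → rot₁ i j ∈ C
    rot₁∈conjugates {j} j≤i = subst (_∈ C) (sym (rot₁≡rotation i j)) (rotation∈ (b ^ (i ∸ j)) (b ^ j ++ W) (begin
      b ^ i ++ W                    ≡⟨ cong (_++ W) (^-∸ b j≤i) ⟩
      (b ^ (i ∸ j) ++ b ^ j) ++ W   ≡⟨ ++-assoc (b ^ (i ∸ j)) (b ^ j) W ⟩
      b ^ (i ∸ j) ++ b ^ j ++ W     ∎))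
      where W = a ∷ a ∷ a ∷ b ^ i ++ a ∷ b ∷ a ^ (i ∸ 1)

    rot₂∈conjugates : ∀ {m} → m ≤ 3 → rot₂ i m ∈ C
    rot₂∈conjugates {m} m≤3 = subst (_∈ C) (sym (rot₂≡rotation i m)) (rotation∈ (b ^ i ++ a ^ (3 ∸ m)) (a ^ m ++ W) (begin
      b ^ i ++ a ^ 3 ++ W                    ≡⟨ cong (λ z → b ^ i ++ z ++ W) (^-∸ a m≤3) ⟩
      b ^ i ++ (a ^ (3 ∸ m) ++ a ^ m) ++ W   ≡⟨ cong (b ^ i ++_) (++-assoc (a ^ (3 ∸ m)) (a ^ m) W) ⟩
      b ^ i ++ a ^ (3 ∸ m) ++ a ^ m ++ W     ≡⟨ ++-assoc (b ^ i) (a ^ (3 ∸ m)) _ ⟨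
      (b ^ i ++ a ^ (3 ∸ m)) ++ a ^ m ++ W   ∎))
      where W = b ^ i ++ a ∷ b ∷ a ^ (i ∸ 1)

    rot₃∈conjugates : ∀ {j} → j ≤ i → rot₃ i j ∈ C
    rot₃∈conjugates {j} j≤i = subst (_∈ C) (sym (rot₃≡rotation i j)) (rotation∈ (b ^ i ++ a ∷ a ∷ a ∷ b ^ (i ∸ j)) (b ^ j ++ W) (begin
      b ^ i ++ a ∷ a ∷ a ∷ b ^ i ++ W                   ≡⟨ cong (λ z → b ^ i ++ a ∷ a ∷ a ∷ z ++ W) (^-∸ b j≤i) ⟩
      b ^ i ++ a ∷ a ∷ a ∷ (b ^ (i ∸ j) ++ b ^ j) ++ W   ≡⟨ cong (λ z → b ^ i ++ a ∷ a ∷ a ∷ z) (++-assoc (b ^ (i ∸ j)) (b ^ j) W) ⟩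
      b ^ i ++ a ∷ a ∷ a ∷ b ^ (i ∸ j) ++ b ^ j ++ W     ≡⟨ ++-assoc (b ^ i) (a ∷ a ∷ a ∷ b ^ (i ∸ j)) _ ⟨
      (b ^ i ++ a ∷ a ∷ a ∷ b ^ (i ∸ j)) ++ b ^ j ++ W   ∎))
      where W = a ∷ b ∷ a ^ (i ∸ 1)

    rot₄∈conjugates : rot₄ i ∈ C
    rot₄∈conjugates = rotation∈ (b ^ i ++ a ∷ a ∷ a ∷ b ^ i) (a ∷ b ∷ a ^ (i ∸ 1)) (sym (++-assoc (b ^ i) (a ∷ a ∷ a ∷ b ^ i) (a ∷ b ∷ a ^ (i ∸ 1))))

    rot₅∈conjugates : rot₅ i ∈ C
    rot₅∈conjugates = rotation∈ (b ^ i ++ a ∷ a ∷ a ∷ b ^ i ++ a ∷ []) (b ∷ a ^ (i ∸ 1)) (sym (++-assoc₃ (b ^ i) (a ∷ a ∷ a ∷ b ^ i) (a ∷ []) (b ∷ a ^ (i ∸ 1))))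

    rot₆∈conjugates : ∀ {m} → m ≤ i ∸ 1 → rot₆ i m ∈ C
    rot₆∈conjugates {m} m≤i-1 = rotation∈ (b ^ i ++ a ∷ a ∷ a ∷ b ^ i ++ a ∷ b ∷ a ^ (i ∸ 1 ∸ m)) (a ^ m) (begin
      b ^ i ++ a ∷ a ∷ a ∷ b ^ i ++ a ∷ b ∷ a ^ (i ∸ 1)                      ≡⟨ cong (λ z → b ^ i ++ a ∷ a ∷ a ∷ b ^ i ++ a ∷ b ∷ z) (^-∸ a m≤i-1) ⟩
      b ^ i ++ a ∷ a ∷ a ∷ b ^ i ++ a ∷ b ∷ a ^ (i ∸ 1 ∸ m) ++ a ^ m          ≡⟨ ++-assoc₃ (b ^ i) (a ∷ a ∷ a ∷ b ^ i) (a ∷ b ∷ a ^ (i ∸ 1 ∸ m)) (a ^ m) ⟨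
      (b ^ i ++ a ∷ a ∷ a ∷ b ^ i ++ a ∷ b ∷ a ^ (i ∸ 1 ∸ m)) ++ a ^ m        ∎)

  lastChar-rot₁ : ∀ i j → lastChar (rot₁ i j) ≡ lastOr a (b ^ (i ∸ j))
  lastChar-rot₁ i j = trans (cong lastChar (rot₁≡rotation i j))
    (lastChar-rotation i (b ^ (i ∸ j)) (b ^ j ++ a ∷ a ∷ a ∷ b ^ i ++ a ∷ b ∷ a ^ (i ∸ 1)))

  lastChar-rot₂ : ∀ i m → lastChar (rot₂ i m) ≡ lastOr a (b ^ i ++ a ^ (3 ∸ m))
  lastChar-rot₂ i m = trans (cong lastChar (rot₂≡rotation i m))
    (lastChar-rotation i (b ^ i ++ a ^ (3 ∸ m)) (a ^ m ++ b ^ i ++ a ∷ b ∷ a ^ (i ∸ 1)))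

  lastChar-rot₃ : ∀ i j → lastChar (rot₃ i j) ≡ lastOr a (b ^ (i ∸ j))
  lastChar-rot₃ i j = trans (cong lastChar (rot₃≡rotation i j))
    (trans (lastChar-rotation i (b ^ i ++ a ∷ a ∷ a ∷ b ^ (i ∸ j)) (b ^ j ++ a ∷ b ∷ a ^ (i ∸ 1)))
      (lastOr-++-∷ a (b ^ i) a (a ∷ a ∷ b ^ (i ∸ j))))

  lastChar-rot₄ : ∀ {i} → 1 ≤ i → lastChar (rot₄ i) ≡ b
  lastChar-rot₄ {suc i} _ = trans (lastChar-rotation (suc i) (b ^ suc i ++ a ∷ a ∷ a ∷ b ^ suc i) (a ∷ b ∷ a ^ i))
    (trans (lastOr-++-∷ a (b ^ suc i) a (a ∷ a ∷ b ^ suc i)) (lastOr-^ a b i))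

  lastChar-rot₅ : ∀ i → lastChar (rot₅ i) ≡ a
  lastChar-rot₅ i = trans (lastChar-rotation i (b ^ i ++ a ∷ a ∷ a ∷ b ^ i ++ a ∷ []) (b ∷ a ^ (i ∸ 1)))
    (trans (lastOr-++-∷ a (b ^ i) a (a ∷ a ∷ b ^ i ++ a ∷ [])) (lastOr-++-∷ a (b ^ i) a []))

  lastChar-rot₆ : ∀ i m → lastChar (rot₆ i m) ≡ lastOr b (a ^ (i ∸ 1 ∸ m))
  lastChar-rot₆ i m = trans (lastChar-rotation i (b ^ i ++ a ∷ a ∷ a ∷ W) (a ^ m))
    (trans (lastOr-++-∷ a (b ^ i) a (a ∷ a ∷ W)) (lastOr-++-∷ a (b ^ i) a (b ∷ a ^ (i ∸ 1 ∸ m))))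
    where W = b ^ i ++ a ∷ b ∷ a ^ (i ∸ 1 ∸ m)

  lastChar-rot₁-b : ∀ {i j} → j < i → lastChar (rot₁ i j) ≡ b
  lastChar-rot₁-b {i} {j} j<i = trans (lastChar-rot₁ i j) (lastOr-^-∸ a b j<i)

  lastChar-rot₁-a : ∀ i → lastChar (rot₁ i i) ≡ a
  lastChar-rot₁-a i = trans (lastChar-rot₁ i i) (cong (λ e → lastOr a (b ^ e)) (n∸n≡0 i))

  lastChar-rot₂-b : ∀ {i} → 1 ≤ i → lastChar (rot₂ i 3) ≡ b
  lastChar-rot₂-b {suc i} _ = trans (lastChar-rot₂ (suc i) 3) (trans (cong (lastOr a) (++-identityʳ (b ^ suc i))) (lastOr-^ a b i))

  lastChar-rot₂-a : ∀ i {m} → m < 3 → lastChar (rot₂ i m) ≡ a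
  lastChar-rot₂-a i {m} m<3 = trans (lastChar-rot₂ i m) (trans (lastOr-++ a (b ^ i) (a ^ (3 ∸ m))) (lastOr-^-∸ _ a m<3))

  lastChar-rot₃-b : ∀ {i j} → j < i → lastChar (rot₃ i j) ≡ b
  lastChar-rot₃-b {i} {j} j<i = trans (lastChar-rot₃ i j) (lastOr-^-∸ a b j<i)

  lastChar-rot₃-a : ∀ i → lastChar (rot₃ i i) ≡ a
  lastChar-rot₃-a i = trans (lastChar-rot₃ i i) (cong (λ e → lastOr a (b ^ e)) (n∸n≡0 i))

  lastChar-rot₆-b : ∀ m → lastChar (rot₆ (suc m) m) ≡ b
  lastChar-rot₆-b m = trans (lastChar-rot₆ (suc m) m) (cong (λ e → lastOr b (a ^ e)) (n∸n≡0 m))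

  lastChar-rot₆-a : ∀ {i m} → suc m < i → lastChar (rot₆ i m) ≡ a
  lastChar-rot₆-a {suc i} {m} (s≤s m<i) = trans (lastChar-rot₆ (suc i) m) (lastOr-^-∸ b a m<i)

  lastChar-tailRotation-b : ∀ {j} → j < k → lastChar (tailRotation j) ≡ b
  lastChar-tailRotation-b {j} j<k = trans (lastChar-tailRotation j) (lastOr-^-∸ a b j<k)

  lastChar-tailRotation-a : lastChar (tailRotation k) ≡ a
  lastChar-tailRotation-a = trans (lastChar-tailRotation k) (cong (λ e → lastOr a (b ^ e)) (n∸n≡0 n))

  rot₆<ˡrot₆ : ∀ {i} m → suc i ≤ 5 + n → rot₆ i m <ˡ rot₆ (suc i) m
  rot₆<ˡrot₆ m i<5+n = <ˡ-++ˡ (a ^ m) (complement<ˡcomplement _ _ ≤-refl i<5+n)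

  rot₂<ˡrot₆ : ∀ {i} m → i ≤ 5 + n → rot₂ i m <ˡ rot₆ i m
  rot₂<ˡrot₆ m i≤5+n = <ˡ-++ˡ (a ^ m) (b^a<ˡcomplement _ _ ≤-refl i≤5+n)

  rot₆<ˡrot₂ : ∀ {i} m → i ≤ 4 + n → rot₆ i m <ˡ rot₂ (suc i) m
  rot₆<ˡrot₂ m i≤4+n = <ˡ-++ˡ (a ^ m) (complement<ˡb^ab _ _ i≤4+n)

  rot₄<ˡrot₄ : ∀ {i} → 1 ≤ i → i ≤ 5 + n → rot₄ (suc i) <ˡ rot₄ i
  rot₄<ˡrot₄ {suc i} _ i≤5+n = more-a<ˡcomplement i _ _ i≤5+n

  rot₄<ˡtailRotation : ∀ {i} → 2 ≤ i → rot₄ i <ˡ tailRotation 0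
  rot₄<ˡtailRotation {suc (suc i)} _ = refl
  rot₄<ˡtailRotation {suc zero} (s≤s ())

  rot₁<ˡrot₁ : ∀ i j → rot₁ i j <ˡ rot₁ (suc i) j
  rot₁<ˡrot₁ i j = <ˡ-++ˡ (b ^ j) (fewer-b-<ˡ {i} {suc i} _ _ ≤-refl)

  rot₁<ˡrot₃ : ∀ i i' j → rot₁ i j <ˡ rot₃ i' j
  rot₁<ˡrot₃ i i' j = <ˡ-++ˡ (b ^ j) refl

  rot₃<ˡrot₃ : ∀ {i} j → 1 ≤ i → i ≤ 5 + n → rot₃ (suc i) j <ˡ rot₃ i j
  rot₃<ˡrot₃ {suc i} j _ i≤5+n = <ˡ-++ˡ (b ^ j) (more-a<ˡcomplement i _ _ i≤5+n)

  rot₁<ˡtailRotation : ∀ i j → rot₁ i j <ˡ tailRotation j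
  rot₁<ˡtailRotation i j = <ˡ-++ˡ (b ^ j) refl

  rot₃<ˡtailRotation : ∀ {i} j → 2 ≤ i → rot₃ i j <ˡ tailRotation j
  rot₃<ˡtailRotation {suc (suc i)} j _ = <ˡ-++ˡ (b ^ j) refl
  rot₃<ˡtailRotation {suc zero} j (s≤s ())

  rot₅<ˡrot₅ : ∀ {i} → 1 ≤ i → i ≤ 5 + n → rot₅ (suc i) <ˡ rot₅ i
  rot₅<ˡrot₅ {suc i} _ i≤5+n = more-a<ˡcomplement i _ _ i≤5+n

  rot₅<ˡrot₁ : ∀ {i} → 5 ≤ i → rot₅ i <ˡ rot₁ 2 1
  rot₅<ˡrot₁ {suc (suc (suc (suc (suc i))))} _ = refl
  rot₅<ˡrot₁ {suc (suc (suc (suc zero)))} (s≤s (s≤s (s≤s (s≤s ()))))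
  rot₅<ˡrot₁ {suc (suc (suc zero))} (s≤s (s≤s (s≤s ())))
  rot₅<ˡrot₁ {suc (suc zero)} (s≤s (s≤s ()))
  rot₅<ˡrot₁ {suc zero} (s≤s ())

  rot₁<ˡrot₅₄ : ∀ {i} → i ≤ 4 → rot₁ i 1 <ˡ rot₅ 4
  rot₁<ˡrot₅₄ {i} i≤4 = b^a<ˡcomplement (b ∷ a ^ (i ∸ 1) ++ complement i ++ b ^ (i ∸ 1)) (b ^ 4 ++ a ∷ a ∷ a ∷ b ^ 4 ++ a ∷ []) i≤4 (s≤s (s≤s (s≤s (s≤s z≤n))))

  rot₅₄<ˡrot₁ : rot₅ 4 <ˡ rot₁ 5 1
  rot₅₄<ˡrot₁ = complement<ˡb^ab (b ^ 4 ++ a ∷ a ∷ a ∷ b ^ 4 ++ a ∷ []) (a ^ 4 ++ complement 5 ++ b ^ 4) (s≤s (s≤s (s≤s (s≤s z≤n))))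

  rot₁<ˡrot₅₃ : ∀ i → rot₁ i 1 <ˡ rot₅ 3
  rot₁<ˡrot₅₃ i = b^a<ˡcomplement (a ∷ a ∷ b ^ i ++ a ∷ b ∷ a ^ (i ∸ 1) ++ complement i ++ b ^ (i ∸ 1)) (b ^ 3 ++ a ∷ a ∷ a ∷ b ^ 3 ++ a ∷ []) z≤n (s≤s (s≤s (s≤s z≤n)))

  rot₅₃<ˡrot₃ : ∀ i → rot₅ 3 <ˡ rot₃ i 1
  rot₅₃<ˡrot₃ i = refl

  tailRotation<ˡrot₅₂ : tailRotation 1 <ˡ rot₅ 2
  tailRotation<ˡrot₅₂ = refl

  tailRotation<ˡrot₂ : tailRotation 0 <ˡ rot₂ 2 1
  tailRotation<ˡrot₂ = refl

  rot₂-StartsAᵐb : ∀ {i} m → 1 ≤ i → StartsAᵐb m (rot₂ i m)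
  rot₂-StartsAᵐb {suc i} m _ = _ , refl

  rot₆-StartsAᵐb : ∀ {i} m → i ≤ 5 + n → StartsAᵐb m (rot₆ i m)
  rot₆-StartsAᵐb m i≤5+n = complement-StartsB m _ i≤5+n

  rot₅-StartsBʲa : ∀ {i} → 2 ≤ i → StartsBʲa 1 (rot₅ i)
  rot₅-StartsBʲa {suc (suc i)} _ = _ , refl
  rot₅-StartsBʲa {suc zero} (s≤s ())

  rot₁-StartsBʲa : ∀ i j → StartsBʲa j (rot₁ i j)
  rot₁-StartsBʲa i j = _ , refl

  rot₃-StartsBʲa : ∀ i j → StartsBʲa j (rot₃ i j)
  rot₃-StartsBʲa i j = _ , refl

module SortedConjugates (n : ℕ) where

  open WordStructure n
  open BlockRotations n

  blocksAbove : ℕ → List ℕ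
  blocksAbove m = ascending (suc m) (5 + n ∸ m)

  blocksAbove-bound : ∀ {m i} → m ≤ 5 + n → i < suc m + (5 + n ∸ m) → i ≤ 5 + n
  blocksAbove-bound m≤5+n i< = ≤-pred (<-+-∸⇒< (s≤s m≤5+n) i<)

  pairs : ℕ → List Word
  pairs m = concat (map (λ i → rot₂ i m ∷ rot₆ i m ∷ []) (blocksAbove m))

  -- aGroup m and bGroup j list the conjugates with prefix a^m b and b^j a in increasing order.
  aGroup : ℕ → List Word
  aGroup 0 = []
  aGroup 1 = map rot₄ (descending 2 (4 + n)) ++ tailRotation 0 ∷ pairs 1
  aGroup 2 = rot₂ 2 2 ∷ pairs 2
  aGroup 3 = rot₂ 2 3 ∷ rot₂ 3 3 ∷ pairs 3
  aGroup m@(suc (suc (suc (suc _)))) = map (λ i → rot₆ i m) (blocksAbove m)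

  bGroup : ℕ → List Word
  bGroup 0 = []
  bGroup 1 = map rot₅ (descending 5 (1 + n)) ++ map (λ i → rot₁ i 1) (ascending 2 3) ++ rot₅ 4 ∷
             map (λ i → rot₁ i 1) (ascending 5 (1 + n)) ++ rot₅ 3 ∷ map (λ i → rot₃ i 1) (descending 2 (4 + n)) ++
             tailRotation 1 ∷ rot₅ 2 ∷ []
  bGroup j@(suc (suc _)) = map (λ i → rot₁ i j) (ascending j (k ∸ j)) ++ map (λ i → rot₃ i j) (descending j (k ∸ j)) ++
                           tailRotation j ∷ []

  pairs-↗ : ∀ m → m ≤ 4 + n → Linked _<ˡ_ (pairs m)
  pairs-↗ m m≤4+n = subst (Linked _<ˡ_) (++-identityʳ (pairs m))
    (Linked-pairs-ascending-++ (λ i → rot₂ i m) (λ i → rot₆ i m) (suc m) (5 + n ∸ m)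
      (λ _ i< → rot₂<ˡrot₆ m (blocksAbove-bound m≤5+n i<))
      (λ _ i+1< → rot₆<ˡrot₂ m (≤-pred (blocksAbove-bound m≤5+n i+1<)))
      (λ _ _ → just-nothing) [])
    where m≤5+n = m≤n⇒m≤1+n m≤4+n

  rot₆s-↗ : ∀ m → m ≤ 4 + n → Linked _<ˡ_ (map (λ i → rot₆ i m) (blocksAbove m))
  rot₆s-↗ m m≤4+n = subst (Linked _<ˡ_) (++-identityʳ _)
    (Linked-map-ascending-++ (λ i → rot₆ i m) (suc m) (5 + n ∸ m)
      (λ _ i+1< → rot₆<ˡrot₆ m (blocksAbove-bound (m≤n⇒m≤1+n m≤4+n) i+1<))
      (λ _ _ → just-nothing) [])

  aGroup-↗ : ∀ m → m ≤ 4 + n → Linked _<ˡ_ (aGroup m)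
  aGroup-↗ 0 _ = []
  aGroup-↗ 1 _ = Linked-map-descending-++ rot₄ 2 (4 + n)
    (λ 2≤i i+1< → rot₄<ˡrot₄ (≤-trans (s≤s z≤n) 2≤i) (≤-pred (≤-trans (n≤1+n _) i+1<)))
    (λ 2≤i _ → just (rot₄<ˡtailRotation 2≤i))
    (tailRotation<ˡrot₂ ∷ pairs-↗ 1 (s≤s z≤n))
  aGroup-↗ 2 _ = refl ∷ pairs-↗ 2 (s≤s (s≤s z≤n))
  aGroup-↗ 3 _ = refl ∷ refl ∷ pairs-↗ 3 (s≤s (s≤s (s≤s z≤n)))
  aGroup-↗ m@(suc (suc (suc (suc _)))) m≤4+n = rot₆s-↗ m m≤4+n

  bGroup-↗ : ∀ j → j ≤ k → Linked _<ˡ_ (bGroup j)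
  bGroup-↗ 0 _ = []
  bGroup-↗ 1 _ =
    Linked-map-descending-++ rot₅ 5 (1 + n)
      (λ 5≤i i+1< → rot₅<ˡrot₅ (≤-trans (s≤s z≤n) 5≤i) (≤-pred (≤-trans (n≤1+n _) i+1<)))
      (λ 5≤i _ → just (rot₅<ˡrot₁ 5≤i))
      (Linked-map-ascending-++ (λ i → rot₁ i 1) 2 3 (λ {i} _ _ → rot₁<ˡrot₁ i 1)
        (λ _ i<5 → just (rot₁<ˡrot₅₄ (≤-pred i<5)))
        (rot₅₄<ˡrot₁ ∷ Linked-map-ascending-++ (λ i → rot₁ i 1) 5 (1 + n) (λ {i} _ _ → rot₁<ˡrot₁ i 1)
          (λ {i} _ _ → just (rot₁<ˡrot₅₃ i))
          (rot₅₃<ˡrot₃ (5 + n) ∷ Linked-map-descending-++ (λ i → rot₃ i 1) 2 (4 + n)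
            (λ 2≤i i+1< → rot₃<ˡrot₃ 1 (≤-trans (s≤s z≤n) 2≤i) (≤-pred (≤-trans (n≤1+n _) i+1<)))
            (λ 2≤i _ → just (rot₃<ˡtailRotation 1 2≤i))
            (tailRotation<ˡrot₅₂ ∷ [-]))))
  bGroup-↗ j@(suc (suc _)) j≤k =
    Linked-map-ascending-++ (λ i → rot₁ i j) j (k ∸ j) (λ {i} _ _ → rot₁<ˡrot₁ i j)
      (λ {i} _ _ → Connected-head-map-++ (λ i' → rot₃ i' j) (descending j (k ∸ j)) (λ i' → rot₁<ˡrot₃ i i' j) (rot₁<ˡtailRotation i j))
      (Linked-map-descending-++ (λ i → rot₃ i j) j (k ∸ j)
        (λ j≤i i+1< → rot₃<ˡrot₃ j (≤-trans (s≤s z≤n) j≤i) (≤-pred (≤-trans (n≤1+n _) (<-+-∸⇒< j≤k i+1<))))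
        (λ j≤i _ → just (rot₃<ˡtailRotation j (≤-trans (s≤s (s≤s z≤n)) j≤i)))
        [-])

  All-pairs : ∀ {P : Word → Set} m → m ≤ 5 + n →
    (∀ {i} → suc m ≤ i → i ≤ 5 + n → P (rot₂ i m)) → (∀ {i} → suc m ≤ i → i ≤ 5 + n → P (rot₆ i m)) → All P (pairs m)
  All-pairs m m≤5+n P₂ P₆ = All.concat⁺ (All.map⁺ (All-ascending (suc m) (5 + n ∸ m)
    (λ m<i i< → P₂ m<i (blocksAbove-bound m≤5+n i<) ∷ P₆ m<i (blocksAbove-bound m≤5+n i<) ∷ [])))

  All-rot₆s : ∀ {P : Word → Set} m → m ≤ 5 + n → (∀ {i} → suc m ≤ i → i ≤ 5 + n → P (rot₆ i m)) →
    All P (map (λ i → rot₆ i m) (blocksAbove m))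
  All-rot₆s m m≤5+n P₆ = All.map⁺ (All-ascending (suc m) (5 + n ∸ m) (λ m<i i< → P₆ m<i (blocksAbove-bound m≤5+n i<)))

  aGroup-StartsAᵐb : ∀ m → m ≤ 4 + n → All (StartsAᵐb m) (aGroup m)
  aGroup-StartsAᵐb 0 _ = []
  aGroup-StartsAᵐb 1 m≤ = All.++⁺ (All.map⁺ (All-descending 2 (4 + n) (λ _ _ → _ , refl)))
    ((_ , refl) ∷ All-pairs 1 (m≤n⇒m≤1+n m≤) (λ 2≤i _ → rot₂-StartsAᵐb 1 (≤-trans (s≤s z≤n) 2≤i)) (λ _ i≤ → rot₆-StartsAᵐb 1 i≤))
  aGroup-StartsAᵐb 2 m≤ = (_ , refl) ∷ All-pairs 2 (m≤n⇒m≤1+n m≤) (λ 3≤i _ → rot₂-StartsAᵐb 2 (≤-trans (s≤s z≤n) 3≤i)) (λ _ i≤ → rot₆-StartsAᵐb 2 i≤)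
  aGroup-StartsAᵐb 3 m≤ = (_ , refl) ∷ (_ , refl) ∷ All-pairs 3 (m≤n⇒m≤1+n m≤) (λ 4≤i _ → rot₂-StartsAᵐb 3 (≤-trans (s≤s z≤n) 4≤i)) (λ _ i≤ → rot₆-StartsAᵐb 3 i≤)
  aGroup-StartsAᵐb m@(suc (suc (suc (suc _)))) m≤ = All-rot₆s m (m≤n⇒m≤1+n m≤) (λ _ i≤ → rot₆-StartsAᵐb m i≤)

  bGroup-StartsBʲa : ∀ j → All (StartsBʲa j) (bGroup j)
  bGroup-StartsBʲa 0 = []
  bGroup-StartsBʲa 1 =
    All.++⁺ (All.map⁺ (All-descending 5 (1 + n) (λ 5≤i _ → rot₅-StartsBʲa (≤-trans (s≤s (s≤s z≤n)) 5≤i))))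
    (All.++⁺ (All.map⁺ (All-ascending 2 3 (λ {i} _ _ → rot₁-StartsBʲa i 1))) ((_ , refl) ∷
    All.++⁺ (All.map⁺ (All-ascending 5 (1 + n) (λ {i} _ _ → rot₁-StartsBʲa i 1))) ((_ , refl) ∷
    All.++⁺ (All.map⁺ (All-descending 2 (4 + n) (λ {i} _ _ → rot₃-StartsBʲa i 1))) ((_ , refl) ∷ (_ , refl) ∷ []))))
  bGroup-StartsBʲa j@(suc (suc _)) =
    All.++⁺ (All.map⁺ (All-ascending j (k ∸ j) (λ {i} _ _ → rot₁-StartsBʲa i j)))
    (All.++⁺ (All.map⁺ (All-descending j (k ∸ j) (λ {i} _ _ → rot₃-StartsBʲa i j))) ((_ , refl) ∷ []))

  private
    C = conjugates (ŵ k)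

    <⇒≤∸1 : ∀ {m i} → m < i → m ≤ i ∸ 1
    <⇒≤∸1 (s≤s m≤i-1) = m≤i-1

    2≤5+n : 2 ≤ 5 + n
    2≤5+n = s≤s (s≤s z≤n)

  pairs⊆conjugates : ∀ m → 1 ≤ m → m ≤ 3 → All (_∈ C) (pairs m)
  pairs⊆conjugates m 1≤m m≤3 = All-pairs m (≤-trans m≤3 (s≤s (s≤s (s≤s z≤n))))
    (λ m<i i≤ → rot₂∈conjugates (≤-trans (s≤s 1≤m) m<i) i≤ m≤3)
    (λ m<i i≤ → rot₆∈conjugates (≤-trans (s≤s 1≤m) m<i) i≤ (<⇒≤∸1 m<i))

  aGroup⊆conjugates : ∀ m → m ≤ 4 + n → All (_∈ C) (aGroup m)
  aGroup⊆conjugates 0 _ = []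
  aGroup⊆conjugates 1 _ = All.++⁺ (All.map⁺ (All-descending 2 (4 + n) (λ 2≤i i< → rot₄∈conjugates 2≤i (≤-pred i<))))
    (tailRotation∈conjugates-ŵ z≤n ∷ pairs⊆conjugates 1 ≤-refl (s≤s z≤n))
  aGroup⊆conjugates 2 _ = rot₂∈conjugates ≤-refl 2≤5+n (s≤s (s≤s z≤n)) ∷ pairs⊆conjugates 2 (s≤s z≤n) (s≤s (s≤s z≤n))
  aGroup⊆conjugates 3 _ = rot₂∈conjugates ≤-refl 2≤5+n ≤-refl ∷ rot₂∈conjugates (s≤s (s≤s z≤n)) (s≤s (s≤s (s≤s z≤n))) ≤-refl
    ∷ pairs⊆conjugates 3 (s≤s z≤n) ≤-refl
  aGroup⊆conjugates m@(suc (suc (suc (suc _)))) m≤ = All-rot₆s m (m≤n⇒m≤1+n m≤)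
    (λ m<i i≤ → rot₆∈conjugates (≤-trans (s≤s (s≤s z≤n)) m<i) i≤ (<⇒≤∸1 m<i))

  bGroup⊆conjugates : ∀ j → j ≤ k → All (_∈ C) (bGroup j)
  bGroup⊆conjugates 0 _ = []
  bGroup⊆conjugates 1 _ =
    All.++⁺ (All.map⁺ (All-descending 5 (1 + n) (λ 5≤i i< → rot₅∈conjugates (≤-trans (s≤s (s≤s z≤n)) 5≤i) (≤-pred i<))))
    (All.++⁺ (All.map⁺ (All-ascending 2 3 (λ 2≤i i< → rot₁∈conjugates 2≤i (≤-trans (≤-pred i<) (s≤s (s≤s (s≤s (s≤s z≤n))))) (≤-trans (s≤s z≤n) 2≤i))))
    (rot₅∈conjugates (s≤s (s≤s z≤n)) (s≤s (s≤s (s≤s (s≤s z≤n)))) ∷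
    All.++⁺ (All.map⁺ (All-ascending 5 (1 + n) (λ 5≤i i< → rot₁∈conjugates (≤-trans (s≤s (s≤s z≤n)) 5≤i) (≤-pred i<) (≤-trans (s≤s z≤n) 5≤i))))
    (rot₅∈conjugates (s≤s (s≤s z≤n)) (s≤s (s≤s (s≤s z≤n))) ∷
    All.++⁺ (All.map⁺ (All-descending 2 (4 + n) (λ 2≤i i< → rot₃∈conjugates 2≤i (≤-pred i<) (≤-trans (s≤s z≤n) 2≤i))))
    (tailRotation∈conjugates-ŵ (s≤s z≤n) ∷ rot₅∈conjugates ≤-refl 2≤5+n ∷ []))))
  bGroup⊆conjugates j@(suc (suc _)) j≤k =
    All.++⁺ (All.map⁺ (All-ascending j (k ∸ j) (λ j≤i i< → rot₁∈conjugates (≤-trans (s≤s (s≤s z≤n)) j≤i) (≤-pred (<-+-∸⇒< j≤k i<)) j≤i)))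
    (All.++⁺ (All.map⁺ (All-descending j (k ∸ j) (λ j≤i i< → rot₃∈conjugates (≤-trans (s≤s (s≤s z≤n)) j≤i) (≤-pred (<-+-∸⇒< j≤k i<)) j≤i)))
    (tailRotation∈conjugates-ŵ j≤k ∷ []))

  aConjugates bConjugates sortedConjugates : List Word
  aConjugates = concat (map aGroup (descending 1 (4 + n)))
  bConjugates = concat (map bGroup (ascending 1 k))
  sortedConjugates = aConjugates ++ bConjugates

  aConjugates-↗ : AllPairs _<ˡ_ aConjugates
  aConjugates-↗ = AllPairs.concat⁺
    (All.map⁺ (All-descending 1 (4 + n) (λ _ m< → Linked⇒AllPairs (λ {u} {v} {w} → <ˡ-trans {u} {v} {w}) (aGroup-↗ _ (≤-pred m<)))))
    (AllPairs.map⁺ (AllPairs-descending 1 (4 + n) (λ {m} {m'} _ m'<m m< →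
      All-All (StartsAᵐb-<ˡ m'<m) (aGroup-StartsAᵐb m (≤-pred m<)) (aGroup-StartsAᵐb m' (≤-pred (<-trans m'<m m<))))))

  bConjugates-↗ : AllPairs _<ˡ_ bConjugates
  bConjugates-↗ = AllPairs.concat⁺
    (All.map⁺ (All-ascending 1 k (λ _ j< → Linked⇒AllPairs (λ {u} {v} {w} → <ˡ-trans {u} {v} {w}) (bGroup-↗ _ (≤-pred j<)))))
    (AllPairs.map⁺ (AllPairs-ascending 1 k (λ {j} {j'} _ j<j' _ →
      All-All (StartsBʲa-<ˡ j<j') (bGroup-StartsBʲa j) (bGroup-StartsBʲa j'))))

  aConjugates-StartsA : All (λ u → ∃[ m ] StartsAᵐb (suc m) u) aConjugates
  aConjugates-StartsA = All.concat⁺ (All.map⁺ {f = aGroup} (All-descending 1 (4 + n)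
    (λ { {suc m} _ m< → All.map (m ,_) (aGroup-StartsAᵐb (suc m) (≤-pred m<)) })))

  bConjugates-StartsB : All (λ u → ∃[ j ] StartsBʲa (suc j) u) bConjugates
  bConjugates-StartsB = All.concat⁺ (All.map⁺ {f = bGroup} (All-ascending 1 k
    (λ { {suc j} _ _ → All.map (j ,_) (bGroup-StartsBʲa (suc j)) })))

  sortedConjugates-↗ : AllPairs _<ˡ_ sortedConjugates
  sortedConjugates-↗ = AllPairs.++⁺ aConjugates-↗ bConjugates-↗
    (All-All (λ (_ , u-a) (_ , v-b) → StartsAᵐb-<ˡ-StartsBʲa u-a v-b) aConjugates-StartsA bConjugates-StartsB)

  sortedConjugates⊆conjugates : All (_∈ C) sortedConjugates
  sortedConjugates⊆conjugates = All.++⁺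
    (All.concat⁺ (All.map⁺ (All-descending 1 (4 + n) (λ _ m< → aGroup⊆conjugates _ (≤-pred m<)))))
    (All.concat⁺ (All.map⁺ (All-ascending 1 k (λ _ j< → bGroup⊆conjugates _ (≤-pred j<)))))

module Counting (n : ℕ) where

  open WordStructure n
  open BlockRotations n
  open SortedConjugates n

  length-pairs : ∀ m → length (pairs m) ≡ 2 * (5 + n ∸ m)
  length-pairs m = trans (length-concat-map-pairs (λ i → rot₂ i m) (λ i → rot₆ i m) (blocksAbove m)) (cong (2 *_) (length-ascending (suc m) (5 + n ∸ m)))

  length-aGroup-≥4 : ∀ m → 4 ≤ m → length (aGroup m) ≡ 5 + n ∸ m
  length-aGroup-≥4 m@(suc (suc (suc (suc _)))) _ = length-map-ascending (λ i → rot₆ i m) (suc m) (5 + n ∸ m)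
  length-aGroup-≥4 3 (s≤s (s≤s (s≤s ())))
  length-aGroup-≥4 2 (s≤s (s≤s ()))
  length-aGroup-≥4 1 (s≤s ())

  length-aGroup-1 : length (aGroup 1) ≡ (4 + n) + suc (2 * (4 + n))
  length-aGroup-1 = trans (length-++ (map rot₄ (descending 2 (4 + n))))
    (cong₂ (λ x y → x + suc y) (length-map-descending rot₄ 2 (4 + n)) (length-pairs 1))

  length-aConjugates : length aConjugates ≡
    sum (ascending 1 (1 + n)) + (suc (suc (2 * (2 + n))) + (suc (2 * (3 + n)) + (((4 + n) + suc (2 * (4 + n))) + 0)))
  length-aConjugates = begin
    length aConjugates
      ≡⟨ length-concat-map aGroup (descending 1 (4 + n)) ⟩
    sum (map (length ∘ aGroup) (descending 1 (3 + (1 + n))))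
      ≡⟨ cong (sum ∘ map (length ∘ aGroup)) (descending-++ 1 3 (1 + n)) ⟩
    sum (map (length ∘ aGroup) (descending 4 (1 + n) ++ descending 1 3))
      ≡⟨ cong sum (map-++ (length ∘ aGroup) (descending 4 (1 + n)) _) ⟩
    sum (map (length ∘ aGroup) (descending 4 (1 + n)) ++ map (length ∘ aGroup) (descending 1 3))
      ≡⟨ sum-++ (map (length ∘ aGroup) (descending 4 (1 + n))) _ ⟩
    sum (map (length ∘ aGroup) (descending 4 (1 + n))) + sum (map (length ∘ aGroup) (descending 1 3))
      ≡⟨ cong₂ _+_ (cong sum group-lengths) small ⟩
    sum (ascending 1 (1 + n)) + (suc (suc (2 * (2 + n))) + (suc (2 * (3 + n)) + (((4 + n) + suc (2 * (4 + n))) + 0))) ∎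
    where
    group-lengths : map (length ∘ aGroup) (descending 4 (1 + n)) ≡ ascending 1 (1 + n)
    group-lengths = trans (map-cong-local (All-descending 4 (1 + n) (λ 4≤m _ → length-aGroup-≥4 _ 4≤m)))
                 (map-∸-descending (5 + n) 1 4 (1 + n) refl)
    small : sum (map (length ∘ aGroup) (descending 1 3)) ≡ suc (suc (2 * (2 + n))) + (suc (2 * (3 + n)) + (((4 + n) + suc (2 * (4 + n))) + 0))
    small = cong₂ _+_ (cong (suc ∘ suc) (length-pairs 3)) (cong₂ _+_ (cong suc (length-pairs 2)) (cong (_+ 0) length-aGroup-1))

  length-bGroup : ∀ j → 2 ≤ j → length (bGroup j) ≡ 2 * (k ∸ j) + 1
  length-bGroup j@(suc (suc _)) _ = begin
    length (map (λ i → rot₁ i j) (ascending j d) ++ map (λ i → rot₃ i j) (descending j d) ++ tailRotation j ∷ [])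
      ≡⟨ length-++ (map (λ i → rot₁ i j) (ascending j d)) ⟩
    length (map (λ i → rot₁ i j) (ascending j d)) + length (map (λ i → rot₃ i j) (descending j d) ++ tailRotation j ∷ [])
      ≡⟨ cong (length (map (λ i → rot₁ i j) (ascending j d)) +_) (length-++ (map (λ i → rot₃ i j) (descending j d))) ⟩
    length (map (λ i → rot₁ i j) (ascending j d)) + (length (map (λ i → rot₃ i j) (descending j d)) + 1)
      ≡⟨ cong₂ (λ x y → x + (y + 1)) (length-map-ascending (λ i → rot₁ i j) j d) (length-map-descending (λ i → rot₃ i j) j d) ⟩
    d + (d + 1)
      ≡⟨ lemma d ⟩
    2 * d + 1 ∎
    where
    d = k ∸ j
    lemma : ∀ d → d + (d + 1) ≡ 2 * d + 1
    lemma = solve-∀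
  length-bGroup 1 (s≤s ())

  length-bGroup-1 : length (bGroup 1) ≡ 13 + 3 * n
  length-bGroup-1 = begin
    length (map rot₅ (descending 5 (1 + n)) ++ ys)
      ≡⟨ length-++ (map rot₅ (descending 5 (1 + n))) ⟩
    length (map rot₅ (descending 5 (1 + n))) + (3 + suc (length (map (λ i → rot₁ i 1) (ascending 5 (1 + n)) ++ zs)))
      ≡⟨ cong₂ (λ x y → x + (3 + suc y)) (length-map-descending rot₅ 5 (1 + n)) (length-++ (map (λ i → rot₁ i 1) (ascending 5 (1 + n)))) ⟩
    (1 + n) + (3 + suc (length (map (λ i → rot₁ i 1) (ascending 5 (1 + n))) + suc (length (map (λ i → rot₃ i 1) (descending 2 (4 + n)) ++ us))))
      ≡⟨ cong₂ (λ x y → (1 + n) + (3 + suc (x + suc y))) (length-map-ascending (λ i → rot₁ i 1) 5 (1 + n)) (length-++ (map (λ i → rot₃ i 1) (descending 2 (4 + n)))) ⟩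
    (1 + n) + (3 + suc ((1 + n) + suc (length (map (λ i → rot₃ i 1) (descending 2 (4 + n))) + 2)))
      ≡⟨ cong (λ x → (1 + n) + (3 + suc ((1 + n) + suc (x + 2)))) (length-map-descending (λ i → rot₃ i 1) 2 (4 + n)) ⟩
    (1 + n) + (3 + suc ((1 + n) + suc ((4 + n) + 2)))
      ≡⟨ lemma n ⟩
    13 + 3 * n ∎
    where
    us = tailRotation 1 ∷ rot₅ 2 ∷ []
    zs = rot₅ 3 ∷ map (λ i → rot₃ i 1) (descending 2 (4 + n)) ++ us
    ys = map (λ i → rot₁ i 1) (ascending 2 3) ++ rot₅ 4 ∷ map (λ i → rot₁ i 1) (ascending 5 (1 + n)) ++ zs
    lemma : ∀ n → (1 + n) + (3 + suc ((1 + n) + suc ((4 + n) + 2))) ≡ 13 + 3 * n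
    lemma = solve-∀

  length-bConjugates : length bConjugates ≡ (13 + 3 * n) + (2 * sum (descending 0 (5 + n)) + 1 * (5 + n))
  length-bConjugates = begin
    length (bGroup 1 ++ concat (map bGroup (ascending 2 (5 + n))))
      ≡⟨ length-++ (bGroup 1) ⟩
    length (bGroup 1) + length (concat (map bGroup (ascending 2 (5 + n))))
      ≡⟨ cong₂ _+_ length-bGroup-1 (length-concat-map bGroup (ascending 2 (5 + n))) ⟩
    (13 + 3 * n) + sum (map (length ∘ bGroup) (ascending 2 (5 + n)))
      ≡⟨ cong (λ l → (13 + 3 * n) + sum l) group-lengths ⟩
    (13 + 3 * n) + sum (map (λ t → 2 * t + 1) (descending 0 (5 + n)))
      ≡⟨ cong ((13 + 3 * n) +_) (sum-map-linear 2 1 (descending 0 (5 + n))) ⟩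
    (13 + 3 * n) + (2 * sum (descending 0 (5 + n)) + 1 * length (descending 0 (5 + n)))
      ≡⟨ cong (λ l → (13 + 3 * n) + (2 * sum (descending 0 (5 + n)) + 1 * l)) (length-descending 0 (5 + n)) ⟩
    (13 + 3 * n) + (2 * sum (descending 0 (5 + n)) + 1 * (5 + n)) ∎
    where
    group-lengths : map (length ∘ bGroup) (ascending 2 (5 + n)) ≡ map (λ t → 2 * t + 1) (descending 0 (5 + n))
    group-lengths = begin
      map (length ∘ bGroup) (ascending 2 (5 + n))              ≡⟨ map-cong-local (All-ascending 2 (5 + n) (λ 2≤j _ → length-bGroup _ 2≤j)) ⟩
      map ((λ t → 2 * t + 1) ∘ (k ∸_)) (ascending 2 (5 + n))   ≡⟨ map-∘ (ascending 2 (5 + n)) ⟩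
      map (λ t → 2 * t + 1) (map (k ∸_) (ascending 2 (5 + n)))  ≡⟨ cong (map (λ t → 2 * t + 1)) (map-∸-ascending k 0 2 (5 + n) refl) ⟩
      map (λ t → 2 * t + 1) (descending 0 (5 + n))              ∎

  length-block : ∀ i → 1 ≤ i → length (block i) ≡ 3 * i + 4
  length-block (suc i) _ = begin
    length (b ^ suc i ++ a ∷ a ∷ a ∷ b ^ suc i ++ a ∷ b ∷ a ^ i)
      ≡⟨ length-++ (b ^ suc i) ⟩
    length (b ^ suc i) + (3 + length (b ^ suc i ++ a ∷ b ∷ a ^ i))
      ≡⟨ cong (λ x → length (b ^ suc i) + (3 + x)) (length-++ (b ^ suc i)) ⟩
    length (b ^ suc i) + (3 + (length (b ^ suc i) + (2 + length (a ^ i))))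
      ≡⟨ cong₂ (λ x y → x + (3 + (x + (2 + y)))) (length-replicate (suc i)) (length-replicate i) ⟩
    suc i + (3 + (suc i + (2 + i)))
      ≡⟨ lemma i ⟩
    3 * suc i + 4 ∎
    where
    lemma : ∀ i → suc i + (3 + (suc i + (2 + i))) ≡ 3 * suc i + 4
    lemma = solve-∀

  length-conjugates : length (conjugates (ŵ k)) ≡ suc ((3 * sum (ascending 2 (4 + n)) + 4 * (4 + n)) + k)
  length-conjugates = begin
    length (conjugates (ŵ k))                     ≡⟨ length-applyUpTo (λ i → rotate i (ŵ k)) (length (ŵ k)) ⟩
    length (ŵ k)                                  ≡⟨ cong length {ŵ k} {a ∷ blocks 2 (4 + n) ++ b ^ k} ŵ≡ ⟩
    length (a ∷ blocks 2 (4 + n) ++ b ^ k)         ≡⟨ cong suc (length-++ (blocks 2 (4 + n))) ⟩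
    suc (length (blocks 2 (4 + n)) + length (b ^ k)) ≡⟨ cong₂ (λ x y → suc (x + y)) length-blocks (length-replicate k) ⟩
    suc ((3 * sum (ascending 2 (4 + n)) + 4 * (4 + n)) + k) ∎
    where
    length-blocks : length (blocks 2 (4 + n)) ≡ 3 * sum (ascending 2 (4 + n)) + 4 * (4 + n)
    length-blocks = begin
      length (blocks 2 (4 + n))                            ≡⟨ length-concat-map block (ascending 2 (4 + n)) ⟩
      sum (map (length ∘ block) (ascending 2 (4 + n)))     ≡⟨ cong sum (map-cong-local (All-ascending 2 (4 + n) (λ 2≤i _ → length-block _ (≤-trans (s≤s z≤n) 2≤i)))) ⟩
      sum (map (λ i → 3 * i + 4) (ascending 2 (4 + n)))    ≡⟨ sum-map-linear 3 4 (ascending 2 (4 + n)) ⟩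
      3 * sum (ascending 2 (4 + n)) + 4 * length (ascending 2 (4 + n)) ≡⟨ cong (λ l → 3 * sum (ascending 2 (4 + n)) + 4 * l) (length-ascending 2 (4 + n)) ⟩
      3 * sum (ascending 2 (4 + n)) + 4 * (4 + n)          ∎

  length-sortedConjugates : length sortedConjugates ≡ length (conjugates (ŵ k))
  length-sortedConjugates = begin
    length (aConjugates ++ bConjugates)           ≡⟨ length-++ aConjugates ⟩
    length aConjugates + length bConjugates       ≡⟨ cong₂ _+_ length-aConjugates length-bConjugates ⟩
    _                                             ≡⟨ counting n (sum (ascending 1 (1 + n))) (sum (descending 0 (5 + n))) (sum (ascending 2 (4 + n)))
                                                       (sum-ascending 1 (1 + n)) (sum-descending 0 (5 + n)) (sum-ascending 2 (4 + n)) ⟩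
    suc ((3 * sum (ascending 2 (4 + n)) + 4 * (4 + n)) + k) ≡⟨ length-conjugates ⟨
    length (conjugates (ŵ k))                     ∎
    where
    counting : ∀ n S₁ S₂ S₃ →
      2 * S₁ + (1 + n) ≡ (1 + n) * (2 * 1 + (1 + n)) →
      2 * S₂ + (5 + n) ≡ (5 + n) * (2 * 0 + (5 + n)) →
      2 * S₃ + (4 + n) ≡ (4 + n) * (2 * 2 + (4 + n)) →
      (S₁ + (suc (suc (2 * (2 + n))) + (suc (2 * (3 + n)) + (((4 + n) + suc (2 * (4 + n))) + 0)))) + ((13 + 3 * n) + (2 * S₂ + 1 * (5 + n)))
        ≡ suc ((3 * S₃ + 4 * (4 + n)) + (6 + n))
    counting n S₁ S₂ S₃ gauss₁ gauss₂ gauss₃ = *-cancelˡ-≡ _ _ 2 (+-cancelʳ-≡ (1 + n) _ _ (begin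
      2 * LHS + (1 + n)                                                          ≡⟨ lemma₁ n S₁ S₂ ⟩
      (2 * S₁ + (1 + n)) + 2 * (2 * S₂ + (5 + n)) + (78 + 20 * n)                ≡⟨ cong₂ (λ x y → x + 2 * y + (78 + 20 * n)) gauss₁ gauss₂ ⟩
      (1 + n) * (2 * 1 + (1 + n)) + 2 * ((5 + n) * (2 * 0 + (5 + n))) + (78 + 20 * n) ≡⟨ lemma₂ n ⟩
      3 * ((4 + n) * (2 * 2 + (4 + n))) + (35 + 8 * n)                            ≡⟨ cong (λ x → 3 * x + (35 + 8 * n)) gauss₃ ⟨
      3 * (2 * S₃ + (4 + n)) + (35 + 8 * n)                                       ≡⟨ lemma₃ n S₃ ⟩
      2 * RHS + (1 + n)                                                          ∎))
      where
      LHS = (S₁ + (suc (suc (2 * (2 + n))) + (suc (2 * (3 + n)) + (((4 + n) + suc (2 * (4 + n))) + 0)))) + ((13 + 3 * n) + (2 * S₂ + 1 * (5 + n)))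
      RHS = suc ((3 * S₃ + 4 * (4 + n)) + (6 + n))
      lemma₁ : ∀ n S₁ S₂ → 2 * ((S₁ + (suc (suc (2 * (2 + n))) + (suc (2 * (3 + n)) + (((4 + n) + suc (2 * (4 + n))) + 0)))) + ((13 + 3 * n) + (2 * S₂ + 1 * (5 + n)))) + (1 + n)
                              ≡ (2 * S₁ + (1 + n)) + 2 * (2 * S₂ + (5 + n)) + (78 + 20 * n)
      lemma₁ = solve-∀
      lemma₂ : ∀ n → (1 + n) * (2 * 1 + (1 + n)) + 2 * ((5 + n) * (2 * 0 + (5 + n))) + (78 + 20 * n) ≡ 3 * ((4 + n) * (2 * 2 + (4 + n))) + (35 + 8 * n)
      lemma₂ = solve-∀
      lemma₃ : ∀ n S₃ → 3 * (2 * S₃ + (4 + n)) + (35 + 8 * n) ≡ 2 * suc ((3 * S₃ + 4 * (4 + n)) + (6 + n)) + (1 + n)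
      lemma₃ = solve-∀

module Beta (n : ℕ) where

  open WordStructure n
  open SortedConjugates n
  open Counting n

  sort-conjugates : sort (conjugates (ŵ k)) ≡ sortedConjugates
  sort-conjugates = sort≡sorted-enumeration sortedConjugates-↗ (All.lookup sortedConjugates⊆conjugates) length-sortedConjugates

  β-aᵐb : ∀ {i} → 1 ≤ i → i ≤ 4 + n → β (a ^ i ++ b ∷ []) (ŵ k) ≡ map lastChar (aGroup i)
  β-aᵐb {i@(suc _)} 1≤i i≤4+n = cong (map lastChar) (begin
    filter P? (sort (conjugates (ŵ k)))                    ≡⟨ cong (filter P?) sort-conjugates ⟩
    filter P? (aConjugates ++ bConjugates)                 ≡⟨ filter-++ P? aConjugates bConjugates ⟩
    filter P? aConjugates ++ filter P? bConjugates         ≡⟨ cong₂ _++_ selectA (filter-none P? (All.map (λ (_ , u-b) → ¬isPrefix-aᵐb-bʲa u-b) bConjugates-StartsB)) ⟩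
    aGroup i ++ []                                         ≡⟨ ++-identityʳ (aGroup i) ⟩
    aGroup i                                               ∎)
    where
    P? = λ u → isPrefix (a ^ i ++ b ∷ []) u Bool.≟ Bool.true
    selectA : filter P? aConjugates ≡ aGroup i
    selectA = begin
      filter P? aConjugates                                ≡⟨ filter-concat-map P? aGroup (descending 1 (4 + n)) ⟩
      concat (map (filter P? ∘ aGroup) (descending 1 (4 + n))) ≡⟨ concat-map-select (filter P? ∘ aGroup) (descending-unique 1 (4 + n))
                                                                     (∈-descending⁺ 1 (4 + n) 1≤i (s≤s i≤4+n)) others ⟩
      filter P? (aGroup i)                                 ≡⟨ filter-all P? (All.map (isPrefix-aᵐb {i}) (aGroup-StartsAᵐb i i≤4+n)) ⟩
      aGroup i                                             ∎
      where
      others : ∀ {m} → m ∈ descending 1 (4 + n) → m ≢ i → filter P? (aGroup m) ≡ []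
      others {m} m∈ m≢i = let _ , m< = ∈-descending⁻ 1 (4 + n) m∈ in
        filter-none P? (All.map (¬isPrefix-aᵐb (m≢i ∘ sym)) (aGroup-StartsAᵐb m (≤-pred m<)))

  β-bʲa : ∀ {j} → 1 ≤ j → j ≤ k → β (b ^ j ++ a ∷ []) (ŵ k) ≡ map lastChar (bGroup j)
  β-bʲa {j@(suc _)} 1≤j j≤k = cong (map lastChar) (begin
    filter P? (sort (conjugates (ŵ k)))                    ≡⟨ cong (filter P?) sort-conjugates ⟩
    filter P? (aConjugates ++ bConjugates)                 ≡⟨ filter-++ P? aConjugates bConjugates ⟩
    filter P? aConjugates ++ filter P? bConjugates         ≡⟨ cong (_++ filter P? bConjugates) (filter-none P? (All.map (λ (_ , u-a) → ¬isPrefix-bʲa-aᵐb u-a) aConjugates-StartsA)) ⟩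
    filter P? bConjugates                                  ≡⟨ filter-concat-map P? bGroup (ascending 1 k) ⟩
    concat (map (filter P? ∘ bGroup) (ascending 1 k))      ≡⟨ concat-map-select (filter P? ∘ bGroup) (ascending-unique 1 k) (∈-ascending⁺ 1 k 1≤j (s≤s j≤k)) others ⟩
    filter P? (bGroup j)                                   ≡⟨ filter-all P? (All.map (isPrefix-bʲa {j}) (bGroup-StartsBʲa j)) ⟩
    bGroup j                                               ∎)
    where
    P? = λ u → isPrefix (b ^ j ++ a ∷ []) u Bool.≟ Bool.true
    others : ∀ {j''} → j'' ∈ ascending 1 k → j'' ≢ j → filter P? (bGroup j'') ≡ []
    others {j''} _ j''≢j = filter-none P? (All.map (¬isPrefix-bʲa (j''≢j ∘ sym)) (bGroup-StartsBʲa j''))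

  BWT-groups : BWT (ŵ k) ≡ concat (map (map lastChar ∘ aGroup) (descending 1 (4 + n))) ++ concat (map (map lastChar ∘ bGroup) (ascending 1 k))
  BWT-groups = begin
    map lastChar (sort (conjugates (ŵ k)))                  ≡⟨ cong (map lastChar) sort-conjugates ⟩
    map lastChar (aConjugates ++ bConjugates)               ≡⟨ map-++ lastChar aConjugates bConjugates ⟩
    map lastChar aConjugates ++ map lastChar bConjugates    ≡⟨ cong₂ _++_ (map-concat-map lastChar aGroup (descending 1 (4 + n))) (map-concat-map lastChar bGroup (ascending 1 k)) ⟩
    concat (map (map lastChar ∘ aGroup) (descending 1 (4 + n))) ++ concat (map (map lastChar ∘ bGroup) (ascending 1 k)) ∎

  BWT-β : BWT (ŵ k) ≡ prod 2 (k ∸ 1) (λ i → β ((a ^ (k ∸ i)) ++ (b ∷ [])) (ŵ k)) ++ prod 1 k (λ i → β ((b ^ i) ++ (a ∷ [])) (ŵ k))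
  BWT-β = trans BWT-groups (cong₂ _++_ βA βB)
    where
    βₐ = λ m → β (a ^ m ++ b ∷ []) (ŵ k)
    βA : concat (map (map lastChar ∘ aGroup) (descending 1 (4 + n))) ≡ prod 2 (k ∸ 1) (λ i → βₐ (k ∸ i))
    βA = begin
      concat (map (map lastChar ∘ aGroup) (descending 1 (4 + n)))   ≡⟨ cong concat (map-cong-local (All-descending 1 (4 + n) (λ 1≤m m< → sym (β-aᵐb 1≤m (≤-pred m<))))) ⟩
      concat (map βₐ (descending 1 (4 + n)))                         ≡⟨ cong (concat ∘ map βₐ) (map-∸-ascending k 1 2 (4 + n) refl) ⟨
      concat (map βₐ (map (k ∸_) (ascending 2 (4 + n))))             ≡⟨ cong concat (map-∘ {g = βₐ} {f = k ∸_} (ascending 2 (4 + n))) ⟨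
      concat (map (λ i → βₐ (k ∸ i)) (ascending 2 (4 + n)))          ≡⟨ cong (concat ∘ map (λ i → βₐ (k ∸ i))) (applyUpTo-ascending (2 +_) 2 (4 + n) (λ _ → refl)) ⟨
      prod 2 (k ∸ 1) (λ i → βₐ (k ∸ i))                              ∎
    βB : concat (map (map lastChar ∘ bGroup) (ascending 1 k)) ≡ prod 1 k (λ i → β ((b ^ i) ++ (a ∷ [])) (ŵ k))
    βB = begin
      concat (map (map lastChar ∘ bGroup) (ascending 1 k))          ≡⟨ cong concat (map-cong-local (All-ascending 1 k (λ 1≤j j< → sym (β-bʲa 1≤j (≤-pred j<))))) ⟩
      concat (map (λ j → β (b ^ j ++ a ∷ []) (ŵ k)) (ascending 1 k)) ≡⟨ cong (concat ∘ map (λ j → β (b ^ j ++ a ∷ []) (ŵ k))) (applyUpTo-ascending (1 +_) 1 k (λ _ → refl)) ⟨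
      prod 1 k (λ i → β ((b ^ i) ++ (a ∷ [])) (ŵ k))                 ∎

module BetaWords (n : ℕ) where

  open WordStructure n
  open BlockRotations n
  open SortedConjugates n

  β[aᵐb] : ℕ → Word
  β[aᵐb] m = b ∷ a ^ (4 + n ∸ m)

  ab²ᵈab : ℕ → Word
  ab²ᵈab d = a ∷ b ^ d ++ b ^ d ++ a ∷ b ∷ []

  β[bʲa] : ℕ → Word
  β[bʲa] j = ab²ᵈab (5 + n ∸ j)

  β[a³b] β[a²b] β[ab] β[ba] : Word
  β[a³b] = b ^ 5 ++ (a ∷ b ∷ []) ^ʷ n ++ a ∷ []
  β[a²b] = a ∷ a ∷ b ∷ a ^ ((2 + n) + (2 + n))
  β[ab] = b ^ (4 + n) ++ b ∷ a ∷ b ∷ a ^ ((3 + n) + (3 + n))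
  β[ba] = a ^ (1 + n) ++ b ∷ b ∷ b ∷ a ∷ b ^ (1 + n) ++ a ∷ b ^ (4 + n) ++ b ∷ a ∷ []

  lastChars-pairs : ∀ m lo d {c} → suc m < lo → (∀ {i} → lo ≤ i → lastChar (rot₂ i m) ≡ c) →
    map lastChar (concat (map (λ i → rot₂ i m ∷ rot₆ i m ∷ []) (ascending lo d))) ≡ (c ∷ a ∷ []) ^ʷ d
  lastChars-pairs m lo d m+1<lo last₂ = trans (map-concat-map lastChar (λ i → rot₂ i m ∷ rot₆ i m ∷ []) (ascending lo d))
    (concat-map-pairs-replicate (lastChar ∘ (λ i → rot₂ i m)) (lastChar ∘ (λ i → rot₆ i m)) lo d (λ lo≤i _ → last₂ lo≤i)
      (λ lo≤i _ → lastChar-rot₆-a (<-≤-trans m+1<lo lo≤i)))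

  lastChars-aGroup-3 : map lastChar (aGroup 3) ≡ β[a³b]
  lastChars-aGroup-3 = begin
    lastChar (rot₂ 2 3) ∷ lastChar (rot₂ 3 3) ∷ lastChar (rot₂ 4 3) ∷ lastChar (rot₆ 4 3) ∷ map lastChar rest
      ≡⟨ cong₂ _∷_ (lastChar-rot₂-b {2} (s≤s z≤n)) (cong₂ _∷_ (lastChar-rot₂-b {3} (s≤s z≤n)) (cong₂ _∷_ (lastChar-rot₂-b {4} (s≤s z≤n))
           (cong₂ _∷_ (lastChar-rot₆-b 3) (lastChars-pairs 3 5 (1 + n) ≤-refl (λ {i} 5≤i → lastChar-rot₂-b {i} (≤-trans (s≤s z≤n) 5≤i)))))) ⟩
    b ∷ b ∷ b ∷ b ∷ (b ∷ a ∷ []) ^ʷ suc n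
      ≡⟨ cong (λ w → b ∷ b ∷ b ∷ b ∷ w) (ba^ʷ-suc n) ⟩
    b ^ 5 ++ (a ∷ b ∷ []) ^ʷ n ++ a ∷ [] ∎
    where rest = concat (map (λ i → rot₂ i 3 ∷ rot₆ i 3 ∷ []) (ascending 5 (1 + n)))

  lastChars-aGroup-2 : map lastChar (aGroup 2) ≡ β[a²b]
  lastChars-aGroup-2 = begin
    lastChar (rot₂ 2 2) ∷ lastChar (rot₂ 3 2) ∷ lastChar (rot₆ 3 2) ∷ map lastChar rest
      ≡⟨ cong₂ _∷_ (lastChar-rot₂-a 2 (s≤s (s≤s (s≤s z≤n)))) (cong₂ _∷_ (lastChar-rot₂-a 3 (s≤s (s≤s (s≤s z≤n))))
           (cong₂ _∷_ (lastChar-rot₆-b 2) (lastChars-pairs 2 4 (2 + n) ≤-refl (λ {i} _ → lastChar-rot₂-a i (s≤s (s≤s (s≤s z≤n))))))) ⟩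
    a ∷ a ∷ b ∷ (a ∷ a ∷ []) ^ʷ (2 + n)
      ≡⟨ cong (λ w → a ∷ a ∷ b ∷ w) (aa^ʷ (2 + n)) ⟩
    a ∷ a ∷ b ∷ a ^ ((2 + n) + (2 + n)) ∎
    where rest = concat (map (λ i → rot₂ i 2 ∷ rot₆ i 2 ∷ []) (ascending 4 (2 + n)))

  lastChars-aGroup-1 : map lastChar (aGroup 1) ≡ β[ab]
  lastChars-aGroup-1 = begin
    map lastChar (map rot₄ (descending 2 (4 + n)) ++ tailRotation 0 ∷ pairs 1)
      ≡⟨ map-++ lastChar (map rot₄ (descending 2 (4 + n))) _ ⟩
    map lastChar (map rot₄ (descending 2 (4 + n))) ++ lastChar (tailRotation 0) ∷ lastChar (rot₂ 2 1) ∷ lastChar (rot₆ 2 1) ∷ map lastChar rest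
      ≡⟨ cong₂ _++_ (trans (sym (map-∘ (descending 2 (4 + n)))) (map-descending-replicate (lastChar ∘ rot₄) 2 (4 + n) (λ 2≤i _ → lastChar-rot₄ (≤-trans (s≤s z≤n) 2≤i))))
           (cong₂ _∷_ (lastChar-tailRotation-b (s≤s z≤n)) (cong₂ _∷_ (lastChar-rot₂-a 2 (s≤s (s≤s z≤n)))
             (cong₂ _∷_ (lastChar-rot₆-b 1) (lastChars-pairs 1 3 (3 + n) ≤-refl (λ {i} _ → lastChar-rot₂-a i (s≤s (s≤s z≤n))))))) ⟩
    b ^ (4 + n) ++ b ∷ a ∷ b ∷ (a ∷ a ∷ []) ^ʷ (3 + n)
      ≡⟨ cong (λ w → b ^ (4 + n) ++ b ∷ a ∷ b ∷ w) (aa^ʷ (3 + n)) ⟩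
    b ^ (4 + n) ++ b ∷ a ∷ b ∷ a ^ ((3 + n) + (3 + n)) ∎
    where rest = concat (map (λ i → rot₂ i 1 ∷ rot₆ i 1 ∷ []) (ascending 3 (3 + n)))

  lastChars-aGroup-≥4 : ∀ m → 4 ≤ m → m ≤ 4 + n → map lastChar (aGroup m) ≡ β[aᵐb] m
  lastChars-aGroup-≥4 m@(suc (suc (suc (suc _)))) 4≤m m≤4+n = begin
    map lastChar (map (λ i → rot₆ i m) (ascending (suc m) (5 + n ∸ m)))
      ≡⟨ cong (λ d → map lastChar (map (λ i → rot₆ i m) (ascending (suc m) d))) (+-∸-assoc 1 m≤4+n) ⟩
    lastChar (rot₆ (suc m) m) ∷ map lastChar (map (λ i → rot₆ i m) (ascending (2 + m) (4 + n ∸ m)))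
      ≡⟨ cong₂ _∷_ (lastChar-rot₆-b m) (trans (sym (map-∘ (ascending (2 + m) (4 + n ∸ m))))
           (map-ascending-replicate (lastChar ∘ (λ i → rot₆ i m)) (2 + m) (4 + n ∸ m) lastChar-rot₆-a′)) ⟩
    b ∷ a ^ (4 + n ∸ m) ∎
    where
    lastChar-rot₆-a′ : ∀ {i} → 2 + m ≤ i → i < 2 + m + (4 + n ∸ m) → lastChar (rot₆ i m) ≡ a
    lastChar-rot₆-a′ 2+m≤i _ = lastChar-rot₆-a 2+m≤i
  lastChars-aGroup-≥4 3 (s≤s (s≤s (s≤s ()))) _
  lastChars-aGroup-≥4 2 (s≤s (s≤s ())) _
  lastChars-aGroup-≥4 1 (s≤s ()) _

  map-lastChar-++ : ∀ (f : ℕ → Word) xs ys {w} → map (lastChar ∘ f) xs ≡ w → map lastChar (map f xs ++ ys) ≡ w ++ map lastChar ys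
  map-lastChar-++ f xs ys eq = trans (map-++ lastChar (map f xs) ys) (cong (_++ map lastChar ys) (trans (sym (map-∘ xs)) eq))

  lastChars-bGroup-1 : map lastChar (bGroup 1) ≡ β[ba]
  lastChars-bGroup-1 = trans
    (map-lastChar-++ rot₅ (descending 5 (1 + n)) ys₁ (map-descending-replicate (lastChar ∘ rot₅) 5 (1 + n) (λ {i} _ _ → lastChar-rot₅ i)))
    (cong (a ^ (1 + n) ++_) lastChars₁)
    where
    ys₃ = map (λ i → rot₃ i 1) (descending 2 (4 + n)) ++ tailRotation 1 ∷ rot₅ 2 ∷ []
    ys₂ = map (λ i → rot₁ i 1) (ascending 5 (1 + n)) ++ rot₅ 3 ∷ ys₃
    ys₁ = map (λ i → rot₁ i 1) (ascending 2 3) ++ rot₅ 4 ∷ ys₂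
    lastChars₃ : map lastChar ys₃ ≡ b ^ (4 + n) ++ b ∷ a ∷ []
    lastChars₃ = trans
      (map-lastChar-++ (λ i → rot₃ i 1) (descending 2 (4 + n)) _ (map-descending-replicate (lastChar ∘ (λ i → rot₃ i 1)) 2 (4 + n) (λ 2≤i _ → lastChar-rot₃-b 2≤i)))
      (cong (b ^ (4 + n) ++_) (cong₂ _∷_ (lastChar-tailRotation-b (s≤s (s≤s z≤n))) (cong (_∷ []) (lastChar-rot₅ 2))))
    lastChars₂ : map lastChar ys₂ ≡ b ^ (1 + n) ++ a ∷ b ^ (4 + n) ++ b ∷ a ∷ []
    lastChars₂ = trans
      (map-lastChar-++ (λ i → rot₁ i 1) (ascending 5 (1 + n)) _
        (map-ascending-replicate (lastChar ∘ (λ i → rot₁ i 1)) 5 (1 + n) (λ 5≤i _ → lastChar-rot₁-b (≤-trans (s≤s (s≤s z≤n)) 5≤i))))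
      (cong (b ^ (1 + n) ++_) (cong₂ _∷_ (lastChar-rot₅ 3) lastChars₃))
    lastChars₁ : map lastChar ys₁ ≡ b ∷ b ∷ b ∷ a ∷ b ^ (1 + n) ++ a ∷ b ^ (4 + n) ++ b ∷ a ∷ []
    lastChars₁ = cong₂ _∷_ (lastChar-rot₁-b {2} (s≤s (s≤s z≤n))) (cong₂ _∷_ (lastChar-rot₁-b {3} (s≤s (s≤s z≤n)))
      (cong₂ _∷_ (lastChar-rot₁-b {4} (s≤s (s≤s z≤n))) (cong₂ _∷_ (lastChar-rot₅ 4) lastChars₂)))

  rot₃-descending-lastChars : ∀ j d → map (lastChar ∘ (λ i → rot₃ i j)) (descending j (suc d)) ≡ b ^ d ++ a ∷ []
  rot₃-descending-lastChars j d = begin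
    map (lastChar ∘ (λ i → rot₃ i j)) (descending j (suc d))
      ≡⟨ cong (map (lastChar ∘ (λ i → rot₃ i j))) (descending-∷ʳ j d) ⟩
    map (lastChar ∘ (λ i → rot₃ i j)) (descending (suc j) d ++ j ∷ [])
      ≡⟨ map-++ (lastChar ∘ (λ i → rot₃ i j)) (descending (suc j) d) (j ∷ []) ⟩
    map (lastChar ∘ (λ i → rot₃ i j)) (descending (suc j) d) ++ lastChar (rot₃ j j) ∷ []
      ≡⟨ cong₂ _++_ (map-descending-replicate (lastChar ∘ (λ i → rot₃ i j)) (suc j) d (λ j<i _ → lastChar-rot₃-b j<i)) (cong (_∷ []) (lastChar-rot₃-a j)) ⟩
    b ^ d ++ a ∷ [] ∎

  lastChars-bGroup : ∀ j → 2 ≤ j → j ≤ 5 + n → map lastChar (bGroup j) ≡ β[bʲa] j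
  lastChars-bGroup j@(suc (suc _)) _ j≤5+n = begin
    lastChars (k ∸ j)
      ≡⟨ cong lastChars (+-∸-assoc 1 j≤5+n) ⟩
    lastChars (suc d)
      ≡⟨ cong (lastChar (rot₁ j j) ∷_) (map-lastChar-++ (λ i → rot₁ i j) (ascending (suc j) d) _
           (map-ascending-replicate (lastChar ∘ (λ i → rot₁ i j)) (suc j) d (λ j<i _ → lastChar-rot₁-b j<i))) ⟩
    lastChar (rot₁ j j) ∷ b ^ d ++ map lastChar (map (λ i → rot₃ i j) (descending j (suc d)) ++ tailRotation j ∷ [])
      ≡⟨ cong₂ (λ x w → x ∷ b ^ d ++ w) (lastChar-rot₁-a j) (map-lastChar-++ (λ i → rot₃ i j) (descending j (suc d)) _ (rot₃-descending-lastChars j d)) ⟩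
    a ∷ b ^ d ++ (b ^ d ++ a ∷ []) ++ lastChar (tailRotation j) ∷ []
      ≡⟨ cong (λ w → a ∷ b ^ d ++ w) (++-assoc (b ^ d) (a ∷ []) _) ⟩
    a ∷ b ^ d ++ b ^ d ++ a ∷ lastChar (tailRotation j) ∷ []
      ≡⟨ cong (λ c → a ∷ b ^ d ++ b ^ d ++ a ∷ c ∷ []) (lastChar-tailRotation-b (s≤s j≤5+n)) ⟩
    a ∷ b ^ d ++ b ^ d ++ a ∷ b ∷ [] ∎
    where
    d = 5 + n ∸ j
    lastChars : ℕ → Word
    lastChars e = map lastChar (map (λ i → rot₁ i j) (ascending j e) ++ map (λ i → rot₃ i j) (descending j e) ++ tailRotation j ∷ [])
  lastChars-bGroup 1 (s≤s ()) _

  lastChars-bGroup-k : map lastChar (bGroup k) ≡ a ∷ []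
  lastChars-bGroup-k = begin
    lastChars (n ∸ n) ≡⟨ cong lastChars (n∸n≡0 n) ⟩
    lastChars 0       ≡⟨ cong (_∷ []) lastChar-tailRotation-a ⟩
    a ∷ []            ∎
    where
    lastChars : ℕ → Word
    lastChars e = map lastChar (map (λ i → rot₁ i k) (ascending k e) ++ map (λ i → rot₃ i k) (descending k e) ++ tailRotation k ∷ [])

module RunCount (n : ℕ) where

  open WordStructure n
  open SortedConjugates n
  open Beta n
  open BetaWords n

  βs[aᵐb] βs[bʲa] : Word
  βs[aᵐb] = concat (map β[aᵐb] (descending 4 n))
  βs[bʲa] = concat (map β[bʲa] (ascending 3 (2 + n)))

  BWT-aGroups : ∀ v → concat (map (map lastChar ∘ aGroup) (descending 1 (4 + n))) ++ v ≡ b ∷ βs[aᵐb] ++ β[a³b] ++ β[a²b] ++ β[ab] ++ v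
  BWT-aGroups v = begin
    concat (map L (descending 1 (4 + n))) ++ v
      ≡⟨ concat-++ʳ (map L (descending 1 (4 + n))) v ⟩
    foldr _++_ v (map L (descending 1 (3 + (1 + n))))
      ≡⟨ cong (foldr _++_ v ∘ map L) (descending-++ 1 3 (1 + n)) ⟩
    foldr _++_ v (map L (descending 4 (1 + n) ++ 3 ∷ 2 ∷ 1 ∷ []))
      ≡⟨ cong (foldr _++_ v) (map-++ L (descending 4 (1 + n)) (3 ∷ 2 ∷ 1 ∷ [])) ⟩
    foldr _++_ v (map L (descending 4 (1 + n)) ++ L 3 ∷ L 2 ∷ L 1 ∷ [])
      ≡⟨ foldr-++ _++_ v (map L (descending 4 (1 + n))) _ ⟩
    L (4 + n) ++ foldr _++_ (L 3 ++ L 2 ++ L 1 ++ v) (map L (descending 4 n))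
      ≡⟨ cong (L (4 + n) ++_) (concat-++ʳ (map L (descending 4 n)) _) ⟨
    L (4 + n) ++ concat (map L (descending 4 n)) ++ L 3 ++ L 2 ++ L 1 ++ v
      ≡⟨ cong₂ _++_ L₄₊ₙ (cong₂ _++_ Ls (cong₂ _++_ lastChars-aGroup-3 (cong₂ _++_ lastChars-aGroup-2 (cong (_++ v) lastChars-aGroup-1)))) ⟩
    b ∷ βs[aᵐb] ++ β[a³b] ++ β[a²b] ++ β[ab] ++ v ∎
    where
    L = map lastChar ∘ aGroup
    L₄₊ₙ : L (4 + n) ≡ b ∷ []
    L₄₊ₙ = trans (lastChars-aGroup-≥4 (4 + n) (s≤s (s≤s (s≤s (s≤s z≤n)))) ≤-refl) (cong (λ e → b ∷ a ^ e) (n∸n≡0 n))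
    Ls : concat (map L (descending 4 n)) ≡ βs[aᵐb]
    Ls = cong concat (map-cong-local (All-descending 4 n (λ 4≤m m< → lastChars-aGroup-≥4 _ 4≤m (<⇒≤ m<))))

  BWT-bGroups : concat (map (map lastChar ∘ bGroup) (ascending 1 k)) ≡ β[ba] ++ β[bʲa] 2 ++ βs[bʲa] ++ a ∷ a ∷ b ∷ a ∷ []
  BWT-bGroups = begin
    concat (map L (ascending 1 k))
      ≡⟨ concat-++ʳ (map L (ascending 1 k)) [] ⟨
    concat (map L (ascending 1 k)) ++ []
      ≡⟨ concat-++ʳ (map L (ascending 1 k)) [] ⟩
    L 1 ++ L 2 ++ foldr _++_ [] (map L (ascending 3 (4 + n)))
      ≡⟨ cong (λ is → L 1 ++ L 2 ++ foldr _++_ [] (map L is)) (trans (cong (ascending 3) (+-comm 2 (2 + n))) (ascending-++ 3 (2 + n) 2)) ⟩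
    L 1 ++ L 2 ++ foldr _++_ [] (map L (ascending 3 (2 + n) ++ (5 + n) ∷ (6 + n) ∷ []))
      ≡⟨ cong (λ w → L 1 ++ L 2 ++ foldr _++_ [] w) (map-++ L (ascending 3 (2 + n)) _) ⟩
    L 1 ++ L 2 ++ foldr _++_ [] (map L (ascending 3 (2 + n)) ++ L (5 + n) ∷ L (6 + n) ∷ [])
      ≡⟨ cong (λ w → L 1 ++ L 2 ++ w) (foldr-++ _++_ [] (map L (ascending 3 (2 + n))) _) ⟩
    L 1 ++ L 2 ++ foldr _++_ (L (5 + n) ++ L (6 + n) ++ []) (map L (ascending 3 (2 + n)))
      ≡⟨ cong (λ w → L 1 ++ L 2 ++ w) (concat-++ʳ (map L (ascending 3 (2 + n))) _) ⟨
    L 1 ++ L 2 ++ concat (map L (ascending 3 (2 + n))) ++ L (5 + n) ++ L (6 + n) ++ []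
      ≡⟨ cong₂ _++_ lastChars-bGroup-1 (cong₂ _++_ (lastChars-bGroup 2 ≤-refl 2≤5+n) (cong₂ _++_ Ls
           (cong₂ _++_ L₅₊ₙ (cong (_++ []) lastChars-bGroup-k)))) ⟩
    β[ba] ++ β[bʲa] 2 ++ βs[bʲa] ++ a ∷ a ∷ b ∷ a ∷ [] ∎
    where
    L = map lastChar ∘ bGroup
    2≤5+n : 2 ≤ 5 + n
    2≤5+n = s≤s (s≤s z≤n)
    Ls : concat (map L (ascending 3 (2 + n))) ≡ βs[bʲa]
    Ls = cong concat (map-cong-local (All-ascending 3 (2 + n) (λ 3≤j j< → lastChars-bGroup _ (≤-trans (n≤1+n 2) 3≤j) (<⇒≤ j<))))
    L₅₊ₙ : L (5 + n) ≡ a ∷ a ∷ b ∷ []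
    L₅₊ₙ = trans (lastChars-bGroup (5 + n) 2≤5+n ≤-refl) (cong ab²ᵈab (n∸n≡0 n))

  BWT-explicit : BWT (ŵ k) ≡ b ∷ βs[aᵐb] ++ β[a³b] ++ β[a²b] ++ β[ab] ++ β[ba] ++ β[bʲa] 2 ++ βs[bʲa] ++ a ∷ a ∷ b ∷ a ∷ []
  BWT-explicit = begin
    BWT (ŵ k)                                                   ≡⟨ BWT-groups ⟩
    concat (map (map lastChar ∘ aGroup) (descending 1 (4 + n))) ++ B ≡⟨ BWT-aGroups B ⟩
    b ∷ βs[aᵐb] ++ β[a³b] ++ β[a²b] ++ β[ab] ++ B              ≡⟨ cong (λ w → b ∷ βs[aᵐb] ++ β[a³b] ++ β[a²b] ++ β[ab] ++ w) BWT-bGroups ⟩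
    b ∷ βs[aᵐb] ++ β[a³b] ++ β[a²b] ++ β[ab] ++ β[ba] ++ β[bʲa] 2 ++ βs[bʲa] ++ a ∷ a ∷ b ∷ a ∷ [] ∎
    where B = concat (map (map lastChar ∘ bGroup) (ascending 1 k))

  runsFrom-βs[aᵐb] : ∀ ms v → All (_< 4 + n) ms → runsFrom b (concat (map β[aᵐb] ms) ++ b ∷ v) ≡ 2 * length ms + runsFrom b v
  runsFrom-βs[aᵐb] [] v [] = refl
  runsFrom-βs[aᵐb] (m ∷ ms) v (m<4+n ∷ ms<) = begin
    runsFrom b ((β[aᵐb] m ++ concat (map β[aᵐb] ms)) ++ b ∷ v) ≡⟨ cong (runsFrom b) (++-assoc (β[aᵐb] m) _ (b ∷ v)) ⟩
    runsFrom b (b ∷ a ^ (4 + n ∸ m) ++ rest)                   ≡⟨ runs-b∷a^ (4 + n ∸ m) (m>n⇒m∸n≢0 m<4+n) ⟩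
    2 + runsFrom b rest                                        ≡⟨ cong (2 +_) (runsFrom-βs[aᵐb] ms v ms<) ⟩
    2 + (2 * length ms + runsFrom b v)                         ≡⟨ cong (_+ runsFrom b v) (*-suc 2 (length ms)) ⟨
    2 * length (m ∷ ms) + runsFrom b v                         ∎
    where
    rest = concat (map β[aᵐb] ms) ++ b ∷ v
    rest-starts-b : ∀ ms → ∃[ r ] concat (map β[aᵐb] ms) ++ b ∷ v ≡ b ∷ r
    rest-starts-b [] = v , refl
    rest-starts-b (_ ∷ _) = _ , refl
    runs-b∷a^ : ∀ e → e ≢ 0 → runsFrom b (b ∷ a ^ e ++ rest) ≡ 2 + runsFrom b rest
    runs-b∷a^ zero e≢0 = ⊥-elim (e≢0 refl)
    runs-b∷a^ (suc e) _ with rest-starts-b ms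
    ... | r , rest≡b∷r rewrite rest≡b∷r = cong suc (runsFrom-^ a e (b ∷ r))

  runsFrom-ab²ᵈab : ∀ p d → d ≢ 0 → runsFrom p (ab²ᵈab d) ≡ runsFrom p (a ∷ []) + 3
  runsFrom-ab²ᵈab p zero d≢0 = ⊥-elim (d≢0 refl)
  runsFrom-ab²ᵈab a (suc d) _ = cong suc (trans (runsFrom-^ b d _) (runsFrom-^ b (suc d) (a ∷ b ∷ [])))
  runsFrom-ab²ᵈab b (suc d) _ = cong (2 +_) (trans (runsFrom-^ b d _) (runsFrom-^ b (suc d) (a ∷ b ∷ [])))

  lastOr-ab²ᵈab : ∀ p d → lastOr p (ab²ᵈab d) ≡ b
  lastOr-ab²ᵈab p d = trans (lastOr-++ a (b ^ d) _) (lastOr-++-∷ _ (b ^ d) a (b ∷ []))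

  runsFrom-βs[bʲa] : ∀ js v → All (_< 5 + n) js → runsFrom b (concat (map β[bʲa] js) ++ v) ≡ 4 * length js + runsFrom b v
  runsFrom-βs[bʲa] [] v [] = refl
  runsFrom-βs[bʲa] (j ∷ js) v (j<5+n ∷ js<) = begin
    runsFrom b ((β[bʲa] j ++ rest) ++ v)      ≡⟨ cong (runsFrom b) (++-assoc (β[bʲa] j) rest v) ⟩
    runsFrom b (β[bʲa] j ++ rest ++ v)        ≡⟨ runsFrom-++-piece b (β[bʲa] j) (rest ++ v) (runsFrom-ab²ᵈab b (5 + n ∸ j) (m>n⇒m∸n≢0 j<5+n)) (lastOr-ab²ᵈab b (5 + n ∸ j)) ⟩
    4 + runsFrom b (rest ++ v)                ≡⟨ cong (4 +_) (runsFrom-βs[bʲa] js v js<) ⟩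
    4 + (4 * length js + runsFrom b v)        ≡⟨ cong (_+ runsFrom b v) (*-suc 4 (length js)) ⟨
    4 * length (j ∷ js) + runsFrom b v        ∎
    where rest = concat (map β[bʲa] js)

  runsFrom-β[a²b]-onwards : runsFrom a (β[a²b] ++ β[ab] ++ β[ba] ++ β[bʲa] 2 ++ βs[bʲa] ++ a ∷ a ∷ b ∷ a ∷ []) ≡ 2 + (4 + (6 + (3 + (4 * (2 + n) + 3))))
  runsFrom-β[a²b]-onwards = begin
    runsFrom a (β[a²b] ++ β[ab] ++ β[ba] ++ β[bʲa] 2 ++ T)
      ≡⟨ runsFrom-++-piece a β[a²b] _ (cong (2 +_) (runsFrom-^-self a (n + (2 + n)))) (lastOr-^ b a (suc (n + (2 + n)))) ⟩
    2 + runsFrom a (β[ab] ++ β[ba] ++ β[bʲa] 2 ++ T)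
      ≡⟨ cong (2 +_) (runsFrom-++-piece a β[ab] _ β[ab]-runs β[ab]-last) ⟩
    2 + (4 + runsFrom a (β[ba] ++ β[bʲa] 2 ++ T))
      ≡⟨ cong (λ x → 2 + (4 + x)) (runsFrom-++-piece a β[ba] _ β[ba]-runs β[ba]-last) ⟩
    2 + (4 + (6 + runsFrom a (β[bʲa] 2 ++ T)))
      ≡⟨ cong (λ x → 2 + (4 + (6 + x))) (runsFrom-++-piece a (β[bʲa] 2) T (runsFrom-ab²ᵈab a (3 + n) λ ()) (lastOr-ab²ᵈab a (3 + n))) ⟩
    2 + (4 + (6 + (3 + runsFrom b (βs[bʲa] ++ a ∷ a ∷ b ∷ a ∷ []))))
      ≡⟨ cong (λ x → 2 + (4 + (6 + (3 + x)))) (runsFrom-βs[bʲa] (ascending 3 (2 + n)) _ (All-ascending 3 (2 + n) (λ _ j< → j<))) ⟩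
    2 + (4 + (6 + (3 + (4 * length (ascending 3 (2 + n)) + 3))))
      ≡⟨ cong (λ l → 2 + (4 + (6 + (3 + (4 * l + 3))))) (length-ascending 3 (2 + n)) ⟩
    2 + (4 + (6 + (3 + (4 * (2 + n) + 3)))) ∎
    where
    T = βs[bʲa] ++ a ∷ a ∷ b ∷ a ∷ []
    β[ab]-runs : runsFrom a β[ab] ≡ 4
    β[ab]-runs = cong suc (trans (runsFrom-^ b (3 + n) _) (cong (3 +_) (runsFrom-^-self a (n + (3 + n)))))
    β[ab]-last : lastOr a β[ab] ≡ a
    β[ab]-last = trans (lastOr-++-∷ a (b ^ (4 + n)) b _) (lastOr-^ b a (n + (3 + n)))
    β[ba]-runs : runsFrom a β[ba] ≡ 6
    β[ba]-runs = trans (runsFrom-^ a (1 + n) _) (cong (3 +_) (trans (runsFrom-^ b n _) (cong (2 +_) (runsFrom-^ b (3 + n) _))))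
    β[ba]-last : lastOr a β[ba] ≡ a
    β[ba]-last = trans (lastOr-++-∷ a (a ^ (1 + n)) b _) (trans (lastOr-++-∷ a (b ^ (1 + n)) a _) (lastOr-++-∷ a (b ^ (4 + n)) b (a ∷ [])))

  runs-BWT : r (ŵ k) ≡ 8 * k ∸ 20
  runs-BWT = begin
    runs (BWT (ŵ k))
      ≡⟨ cong runs BWT-explicit ⟩
    suc (runsFrom b (βs[aᵐb] ++ β[a³b] ++ R))
      ≡⟨ cong suc (runsFrom-βs[aᵐb] (descending 4 n) _ (All-descending 4 n (λ _ m< → m<))) ⟩
    suc (2 * length (descending 4 n) + runsFrom b (β[a³b] ++ R))
      ≡⟨ cong (λ x → suc (2 * length (descending 4 n) + x))
           (runsFrom-++-piece b β[a³b] R (runsFrom-ab^ʷ n (a ∷ [])) (lastOr-++-∷ b ((a ∷ b ∷ []) ^ʷ n) a [])) ⟩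
    suc (2 * length (descending 4 n) + ((2 * n + 1) + runsFrom a R))
      ≡⟨ cong₂ (λ l x → suc (2 * l + ((2 * n + 1) + x))) (length-descending 4 n) runsFrom-β[a²b]-onwards ⟩
    suc (2 * n + ((2 * n + 1) + (2 + (4 + (6 + (3 + (4 * (2 + n) + 3)))))))
      ≡⟨ arithmetic n ⟩
    8 * k ∸ 20 ∎
    where
    R = β[a²b] ++ β[ab] ++ β[ba] ++ β[bʲa] 2 ++ βs[bʲa] ++ a ∷ a ∷ b ∷ a ∷ []
    arithmetic : ∀ n → suc (2 * n + ((2 * n + 1) + (2 + (4 + (6 + (3 + (4 * (2 + n) + 3))))))) ≡ 8 * (6 + n) ∸ 20
    arithmetic n = sym (trans (cong (_∸ 20) (lemma n)) (m+n∸m≡n 20 _))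
      where
      lemma : ∀ n → 8 * (6 + n) ≡ 20 + suc (2 * n + ((2 * n + 1) + (2 + (4 + (6 + (3 + (4 * (2 + n) + 3)))))))
      lemma = solve-∀

2*[6+n]∸8 : ∀ n → 2 * (6 + n) ∸ 8 ≡ (2 + n) + (2 + n)
2*[6+n]∸8 n = trans (cong (_∸ 8) (lemma n)) (m+n∸m≡n 8 _)
  where
  lemma : ∀ n → 2 * (6 + n) ≡ 8 + ((2 + n) + (2 + n))
  lemma = solve-∀

2*[6+n]∸6 : ∀ n → 2 * (6 + n) ∸ 6 ≡ (3 + n) + (3 + n)
2*[6+n]∸6 n = trans (cong (_∸ 6) (lemma n)) (m+n∸m≡n 6 _)
  where
  lemma : ∀ n → 2 * (6 + n) ≡ 6 + ((3 + n) + (3 + n))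
  lemma = solve-∀

[N∸j]+[N∸j] : ∀ {j N} → j ≤ N → (N ∸ j) + (N ∸ j) ≡ 2 * suc N ∸ 2 * j ∸ 2
[N∸j]+[N∸j] {j} {N} j≤N = sym (begin
  2 * suc N ∸ 2 * j ∸ 2                 ≡⟨ cong (λ x → 2 * suc x ∸ 2 * j ∸ 2) (m+[n∸m]≡n j≤N) ⟨
  2 * suc (j + d) ∸ 2 * j ∸ 2           ≡⟨ cong (λ x → x ∸ 2 * j ∸ 2) (lemma j d) ⟩
  2 * j + (2 + (d + d)) ∸ 2 * j ∸ 2     ≡⟨ cong (_∸ 2) (m+n∸m≡n (2 * j) _) ⟩
  2 + (d + d) ∸ 2                       ≡⟨ m+n∸m≡n 2 (d + d) ⟩
  d + d                                 ∎)
  where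
  d = N ∸ j
  lemma : ∀ j d → 2 * suc (j + d) ≡ 2 * j + (2 + (d + d))
  lemma = solve-∀

lemma19 : (k : ℕ) → 5 < k →
    ((i : ℕ) → 4 ≤ i → i ≤ k ∸ 2 → β ((a ^ i) ++ (b ∷ [])) (ŵ k) ≡ (b ∷ []) ++ (a ^ (k ∸ i ∸ 2)))
    × (β ((a ^ 3) ++ (b ∷ [])) (ŵ k) ≡ (b ^ 5) ++ ((a ∷ b ∷ []) ^ʷ (k ∸ 6)) ++ (a ∷ []))
    × (β ((a ^ 2) ++ (b ∷ [])) (ŵ k) ≡ (a ∷ a ∷ b ∷ []) ++ (a ^ (2 * k ∸ 8)))
    × (β (a ∷ b ∷ []) (ŵ k) ≡ (b ^ (k ∸ 2)) ++ (b ∷ a ∷ b ∷ []) ++ (a ^ (2 * k ∸ 6)))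
    × (β (b ∷ a ∷ []) (ŵ k) ≡ (a ^ (k ∸ 5)) ++ (b ∷ b ∷ b ∷ a ∷ []) ++ (b ^ (k ∸ 5)) ++ (a ∷ []) ++ (b ^ (k ∸ 2)) ++ (b ∷ a ∷ []))
    × ((j : ℕ) → 2 ≤ j → j ≤ k ∸ 1 → β ((b ^ j) ++ (a ∷ [])) (ŵ k) ≡ (a ∷ []) ++ (b ^ (2 * k ∸ 2 * j ∸ 2)) ++ (a ∷ b ∷ []))
    × (β ((b ^ k) ++ (a ∷ [])) (ŵ k) ≡ a ∷ [])
    × (BWT (ŵ k) ≡ prod 2 (k ∸ 1) (λ i → β ((a ^ (k ∸ i)) ++ (b ∷ [])) (ŵ k)) ++ prod 1 k (λ i → β ((b ^ i) ++ (a ∷ [])) (ŵ k)))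
    × (r (ŵ k) ≡ 8 * k ∸ 20)
lemma19 k 5<k with m≤n⇒∃[o]m+o≡n 5<k
... | n , refl =
    (λ i 4≤i i≤k-2 → trans (β-aᵐb (≤-trans (s≤s z≤n) 4≤i) i≤k-2)
       (trans (lastChars-aGroup-≥4 i 4≤i i≤k-2) (cong (λ e → b ∷ a ^ e) (sym (trans (∸-+-assoc k i 2) (cong (k ∸_) (+-comm i 2)))))))
  , trans (β-aᵐb (s≤s z≤n) (s≤s (s≤s (s≤s z≤n)))) lastChars-aGroup-3
  , trans (β-aᵐb (s≤s z≤n) (s≤s (s≤s z≤n))) (trans lastChars-aGroup-2 (cong (λ e → a ∷ a ∷ b ∷ a ^ e) (sym (2*[6+n]∸8 n))))
  , trans (β-aᵐb (s≤s z≤n) (s≤s z≤n)) (trans lastChars-aGroup-1 (cong (λ e → b ^ (4 + n) ++ b ∷ a ∷ b ∷ a ^ e) (sym (2*[6+n]∸6 n))))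
  , trans (β-bʲa (s≤s z≤n) (s≤s z≤n)) lastChars-bGroup-1
  , (λ j 2≤j j≤k-1 → trans (β-bʲa (≤-trans (s≤s z≤n) 2≤j) (≤-trans j≤k-1 (n≤1+n _)))
       (trans (lastChars-bGroup j 2≤j j≤k-1) (cong (a ∷_) (bʲ++bʲ j j≤k-1))))
  , trans (β-bʲa (s≤s z≤n) ≤-refl) lastChars-bGroup-k
  , BWT-β
  , runs-BWT
  where
  open Beta n
  open BetaWords n
  open RunCount n
  bʲ++bʲ : ∀ j → j ≤ 5 + n → b ^ (5 + n ∸ j) ++ b ^ (5 + n ∸ j) ++ a ∷ b ∷ [] ≡ b ^ (2 * k ∸ 2 * j ∸ 2) ++ a ∷ b ∷ []
  bʲ++bʲ j j≤5+n = trans (sym (++-assoc (b ^ (5 + n ∸ j)) _ _)) (cong (_++ a ∷ b ∷ []) (trans (sym (^-+ b (5 + n ∸ j) (5 + n ∸ j))) (cong (b ^_) ([N∸j]+[N∸j] j≤5+n))))
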